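{- Suppose that $p$ is a prime with $p\nmid a_{11}a_{22}a_{33}d$. (1) If $p\nmid D$, then $p>2$, and the number of solutions $(x,y,z)\in(\mathbb{Z}/p\mathbb{Z})^3$ of $$a_{11}x^2+a_{22}y^2+a_{33}z^2+a_{12}xy+a_{13}xz+a_{23}yz\equiv dxyz \pmod p$$ equals $$p^2+\left(\left(\frac{ -A_{11}}{p}\right)_K+\left(\frac{ -A_{22}}{p}\right)_K+\left(\frac{ -A_{33}}{p}\right)_K\right)\cdot p+1.$$ (2) If $2<p\mid D$ and at least two of $A_{11}, A_{22}, A_{33}$ are divisible by $p$, then the solution number is $p^2+1$. (3) If $2<p\mid D$ and at most one of $A_{11}, A_{22}, A_{33}$ is divisible by $p$, then the solution number is $$p^2+\left(\left(\frac{ -A_{11}}{p}\right)_K+\left(\frac{ -A_{22}}{p}\right)_K+\left(\frac{ -A_{33}}{p}\right)_K-\left(\frac{ -A_{jj}}{p}\right)_K\right)\cdot p+1,$$ where $1\leq j\leq 3$ is any index such that $p\nmid A_{jj}$. (4) If $2=p\mid D$, then the solution number is $5$ if $a_{12}\equiv a_{13}\equiv a_{23}\equiv 0\pmod 2$; $1$ if $a_{12}\equiv a_{13}\equiv a_{23}\equiv 1\pmod 2$; and $3$ otherwise.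
   Context: Let $a_{11},a_{22},a_{33},a_{12},a_{13},a_{23},d$ be integers, and consider the Diophantine equation $a_{11}x^2+a_{22}y^2+a_{33}z^2+a_{12}xy+a_{13}xz+a_{23}yz=dxyz$ over $\mathbb{F}_p$. Set $$G=\begin{pmatrix}2a_{11}&a_{12}&a_{13}\\ a_{12}&2a_{22}&a_{23}\\ a_{13}&a_{23}&2a_{33}\end{pmatrix},$$ $A_{11}=4a_{22}a_{33}-a_{23}^2$, $A_{22}=4a_{11}a_{33}-a_{13}^2$, $A_{33}=4a_{11}a_{22}-a_{12}^2$, and $D=\det(G)$. Here $\left(\frac{m}{n}\right)_K$ denotes the Kronecker–Jacobi symbol (Legendre symbol for odd prime $n$). -}

module Defs where

open import Data.Nat as ℕ using (ℕ)
import Data.Nat.Divisibility as ℕD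
open import Data.Integer using (ℤ; +_; -_; _+_; _-_; _*_; ∣_∣; 0ℤ; 1ℤ; -1ℤ)
open import Data.Integer.Divisibility using (_∣_)
open import Data.Fin using (Fin; toℕ)
open import Data.Fin.Properties using (any?)
open import Data.List using (List; length; filter; allFin; cartesianProduct; map)
open import Data.Product using (_×_; _,_; ∃)
open import Relation.Nullary using (Dec; yes; no)

_∣ℤ?_ : (m n : ℤ) → Dec (m ∣ n)
m ∣ℤ? n = ∣ m ∣ ℕD.∣? ∣ n ∣

res : {p : ℕ} → Fin p → ℤ
res x = + toℕ x

-- Legendre symbol (a/p) for a prime p:
-- 0 if p ∣ a, 1 if a is a nonzero square mod p, -1 otherwise.
-- For odd primes p this is the Legendre (= Kronecker–Jacobi) symbol.
legendre : ℤ → ℕ → ℤ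
legendre a p with (+ p) ∣ℤ? a
... | yes _ = 0ℤ
... | no _ with any? {n = p} (λ x → (+ p) ∣ℤ? (res x * res x - a))
...   | yes _ = 1ℤ
...   | no _ = -1ℤ

F : (a11 a22 a33 a12 a13 a23 d : ℤ) → ℤ → ℤ → ℤ → ℤ
F a11 a22 a33 a12 a13 a23 d x y z =
  a11 * x * x + a22 * y * y + a33 * z * z + a12 * x * y + a13 * x * z + a23 * y * z
  - d * x * y * z

triples : (p : ℕ) → List (Fin p × Fin p × Fin p)
triples p = cartesianProduct (allFin p) (cartesianProduct (allFin p) (allFin p))

solCount : (a11 a22 a33 a12 a13 a23 d : ℤ) → (p : ℕ) → ℕ
solCount a11 a22 a33 a12 a13 a23 d p =
  length (filter (λ { (x , y , z) → (+ p) ∣ℤ? F a11 a22 a33 a12 a13 a23 d (res x) (res y) (res z) })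
                 (triples p))

-- cofactors and determinant of the Gram matrix G
A11 A22 A33 : (a11 a22 a33 a12 a13 a23 : ℤ) → ℤ
A11 a11 a22 a33 a12 a13 a23 = + 4 * a22 * a33 - a23 * a23
A22 a11 a22 a33 a12 a13 a23 = + 4 * a11 * a33 - a13 * a13
A33 a11 a22 a33 a12 a13 a23 = + 4 * a11 * a22 - a12 * a12

-- A_jj indexed by j ∈ {1,2,3} (Fin 3 = {0,1,2})
Ajj : (a11 a22 a33 a12 a13 a23 : ℤ) → Fin 3 → ℤ
Ajj a11 a22 a33 a12 a13 a23 Fin.zero = A11 a11 a22 a33 a12 a13 a23
Ajj a11 a22 a33 a12 a13 a23 (Fin.suc Fin.zero) = A22 a11 a22 a33 a12 a13 a23
Ajj a11 a22 a33 a12 a13 a23 (Fin.suc (Fin.suc Fin.zero)) = A33 a11 a22 a33 a12 a13 a23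

-- D = det G, G = [[2a11,a12,a13],[a12,2a22,a23],[a13,a23,2a33]] (cofactor expansion along row 1)
detG : (a11 a22 a33 a12 a13 a23 : ℤ) → ℤ
detG a11 a22 a33 a12 a13 a23 =
  (+ 2 * a11) * ((+ 2 * a22) * (+ 2 * a33) - a23 * a23)
  - a12 * (a12 * (+ 2 * a33) - a23 * a13)
  + a13 * (a12 * a23 - (+ 2 * a22) * a13)

-- Write the equation as E = Q − d·xyz with Q the quadratic part. For p odd and xyz ≢ 0,
-- E(t·v) = t²·(Q(v) − t·d·xyz) has, besides t = 0, exactly one more root t when Q(v) ≢ 0 and
-- none otherwise. Counting the pairs (t, v) with E(t·v) ≡ 0 in two ways gives
-- (p − 1)·N = (p − 1)³ + p·N₀-planes − N₀, where N₀ counts the zeros of Q and N₀-planes those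
-- on the coordinate planes. Solving Q = 0 for z gives N₀ = p² + Σ χ(δ(x, y)), the character sum
-- of a binary quadratic form of discriminant −8·a₃₃·D: it vanishes when p ∤ D and is
-- p(p − 1)·χ(−A_jj) otherwise. On the coordinate planes Q restricts to binary forms of
-- discriminants −A_jj, and inclusion–exclusion gives N₀-planes = 3p − 2 + (p − 1)·Σ χ(−A_jj).
-- When p ∣ D the adjugate identities A_ii·A_jj − C_ij² = 2·a_kk·D equate the nonzero χ(−A_jj)
-- and make the third cofactor vanish with two others. For p = 2 the count only depends on the
-- coefficients modulo 2.

module Submission where

open import Defs
open import Data.Nat using (ℕ; _<_)
open import Data.Nat.Primality using (Prime)
open import Data.Integer using (ℤ; +_; -_; _+_; _-_; _*_; 1ℤ)
open import Data.Integer.Divisibility using (_∣_)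
open import Data.Fin using (Fin)
open import Data.Product using (_×_)
open import Data.Sum using (_⊎_)
open import Relation.Nullary using (¬_)
open import Relation.Binary.PropositionalEquality using (_≡_)

open import Data.Integer.Properties using (+-*-semiring)
open import Algebra.Properties.Semiring.Sum +-*-semiring
  using (sum; sum-syntax; sum-cong-≗; ∑-distrib-+; ∑-comm; *-distribˡ-sum; *-distribʳ-sum; sum-remove; sum-permute)
open import Data.Empty using (⊥-elim)
open import Data.Fin using (zero; suc; toℕ; fromℕ<; punchIn)
open import Data.Fin.Patterns using (0F; 1F; 2F)
open import Data.Fin.Permutation using (Permutation; permutation)
open import Data.Fin.Properties using (any?; punchInᵢ≢i; toℕ-fromℕ<; toℕ-injective; toℕ<n)
open import Data.Integer using (-[1+_]; 0ℤ; -1ℤ; _≤_; +≤+; -≤+; ∣_∣; _/ℕ_; _%ℕ_)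
open import Data.Integer.Base using (≢-nonZero)
import Data.Integer.Divisibility.Signed as Signed
open import Data.Integer.Divisibility.Signed using (divides; ∣ᵤ⇒∣; ∣⇒∣ᵤ; ∣m∣n⇒∣m+n; ∣m⇒∣-m; ∣n⇒∣m*n; ∣m⇒∣m*n)
open import Data.Integer.DivMod using (n%ℕd<d; a≡a%ℕn+[a/ℕn]*n)
open import Data.Integer.Properties
  using ( -1*i≡-i; neg-involutive; neg-distribˡ-*; abs-*; pos-*; pos-+; m-n≡m⊖n; ∣m⊝n∣≤m⊔n; ∣i∣≡0⇒i≡0; +-injective
        ; +-identityˡ; +-identityʳ; +-inverseʳ; *-identityˡ; *-identityʳ; *-zeroˡ; *-zeroʳ; *-comm; *-assoc; +-assoc
        ; *-cancelˡ-≡; ≤-refl; ≤-reflexive; ≤-antisym; +-mono-≤; +-monoˡ-≤; +-monoʳ-≤)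
open import Data.Integer.Tactic.RingSolver using (solve-∀)
open import Data.List using (List; []; _∷_; _++_; map; length; filter; allFin; tabulate; cartesianProduct)
open import Data.Nat as ℕ using (NonZero; zero; suc)
open import Data.Nat.Coprimality using (Coprime; coprime-Bézout)
open import Data.Nat.Divisibility using (>⇒∤) renaming (_∣_ to _∣ℕ_)
import Data.Nat.GCD as GCD
open import Data.Nat.Primality using (euclidsLemma; prime⇒irreducible; prime⇒nonZero; prime⇒nonTrivial)
import Data.Nat.Properties as ℕ
open import Data.Product using (_,_; ∃; proj₁; proj₂)
import Data.Product as Product
import Data.Sum as Sum
open import Data.Sum using (inj₁; inj₂)
open import Function using (_∘_; id)
open import Level using (0ℓ)
open import Relation.Binary.Bundles using (Setoid)
open import Relation.Binary.Core using (_Preserves_⟶_)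
open import Relation.Binary.PropositionalEquality using (_≢_; refl; sym; trans; cong; cong₂; subst; module ≡-Reasoning)
import Relation.Binary.Reasoning.Setoid as SetoidReasoning
open import Relation.Binary.Structures using (IsEquivalence)
open import Relation.Nullary using (Dec; yes; no)
open import Relation.Unary using (Pred; Decidable)

∑-const : ∀ n c → ∑[ i < n ] c ≡ + n * c
∑-const zero c = refl
∑-const (suc n) c = trans (cong (_+_ c) (∑-const n c)) (step c (+ n))
  where
  step : ∀ c n → c + n * c ≡ (1ℤ + n) * c
  step = solve-∀

∑-zero : ∀ {n} {f : Fin n → ℤ} → (∀ i → f i ≡ 0ℤ) → ∑[ i < n ] f i ≡ 0ℤ
∑-zero {n} f≡0 = trans (sum-cong-≗ f≡0) (trans (∑-const n 0ℤ) (*-zeroʳ (+ n)))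

∑-neg : ∀ {n} (f : Fin n → ℤ) → ∑[ i < n ] (- f i) ≡ - ∑[ i < n ] f i
∑-neg f = trans (sum-cong-≗ (λ i → sym (-1*i≡-i (f i))))
                (trans (sym (*-distribˡ-sum -1ℤ f)) (-1*i≡-i (sum f)))

∑-distrib-- : ∀ {n} (f g : Fin n → ℤ) → ∑[ i < n ] (f i - g i) ≡ ∑[ i < n ] f i - ∑[ i < n ] g i
∑-distrib-- f g = trans (∑-distrib-+ f (λ i → - g i)) (cong (_+_ (sum f)) (∑-neg g))

∑-single : ∀ {n} (f : Fin n → ℤ) k → (∀ i → i ≢ k → f i ≡ 0ℤ) → ∑[ i < n ] f i ≡ f k
∑-single {suc n} f k off = begin
  sum f                                  ≡⟨ sum-remove {i = k} f ⟩
  f k + ∑[ i < n ] f (punchIn k i)       ≡⟨ cong (_+_ (f k)) (∑-zero (λ i → off _ (punchInᵢ≢i k i))) ⟩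
  f k + 0ℤ                               ≡⟨ +-identityʳ (f k) ⟩
  f k                                    ∎
  where open ≡-Reasoning

∑-nonpositive : ∀ {n} (f : Fin n → ℤ) → (∀ i → f i ≤ 0ℤ) → ∑[ i < n ] f i ≤ 0ℤ
∑-nonpositive {zero} f f≤0 = ≤-refl
∑-nonpositive {suc n} f f≤0 = +-mono-≤ (f≤0 zero) (∑-nonpositive (λ i → f (suc i)) (λ i → f≤0 (suc i)))

∑-nonpositive-zero : ∀ {n} (f : Fin n → ℤ) → (∀ i → f i ≤ 0ℤ) → ∑[ i < n ] f i ≡ 0ℤ → ∀ k → f k ≡ 0ℤ
∑-nonpositive-zero {suc n} f f≤0 ∑f≡0 k = ≤-antisym (f≤0 k) 0≤fk
  where
  open Data.Integer.Properties.≤-Reasoning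
  0≤fk : 0ℤ ≤ f k
  0≤fk = begin
    0ℤ                                  ≡⟨ sym ∑f≡0 ⟩
    sum f                               ≡⟨ sum-remove {i = k} f ⟩
    f k + ∑[ i < n ] f (punchIn k i)    ≤⟨ +-monoʳ-≤ (f k) (∑-nonpositive (λ i → f (punchIn k i)) (λ i → f≤0 (punchIn k i))) ⟩
    f k + 0ℤ                            ≡⟨ +-identityʳ (f k) ⟩
    f k                                 ∎

𝟙 : ∀ {a} {A : Set a} → Dec A → ℤ
𝟙 (yes _) = 1ℤ
𝟙 (no _) = 0ℤ

module _ {a} {A : Set a} where

  ∑List : (A → ℤ) → List A → ℤ
  ∑List f [] = 0ℤ
  ∑List f (x ∷ xs) = f x + ∑List f xs

  ∑List-++ : ∀ f (xs ys : List A) → ∑List f (xs ++ ys) ≡ ∑List f xs + ∑List f ys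
  ∑List-++ f [] ys = sym (+-identityˡ _)
  ∑List-++ f (x ∷ xs) ys = trans (cong (_+_ (f x)) (∑List-++ f xs ys)) (sym (+-assoc (f x) _ _))

  ∑List-tabulate : ∀ {n} f (g : Fin n → A) → ∑List f (tabulate g) ≡ ∑[ i < n ] f (g i)
  ∑List-tabulate {zero} f g = refl
  ∑List-tabulate {suc n} f g = cong (_+_ (f (g zero))) (∑List-tabulate f (g ∘ suc))

  length-filter : ∀ {p} {P : Pred A p} (P? : Decidable P) xs → + length (filter P? xs) ≡ ∑List (𝟙 ∘ P?) xs
  length-filter P? [] = refl
  length-filter P? (x ∷ xs) with P? x
  ... | yes _ = cong (_+_ 1ℤ) (length-filter P? xs)
  ... | no _ = trans (length-filter P? xs) (sym (+-identityˡ _))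

∑List-map : ∀ {a b} {A : Set a} {B : Set b} (f : B → ℤ) (g : A → B) xs → ∑List f (map g xs) ≡ ∑List (f ∘ g) xs
∑List-map f g [] = refl
∑List-map f g (x ∷ xs) = cong (_+_ (f (g x))) (∑List-map f g xs)

∑List-cartesianProduct : ∀ {a b} {A : Set a} {B : Set b} (f : A × B → ℤ) xs ys →
  ∑List f (cartesianProduct xs ys) ≡ ∑List (λ x → ∑List (λ y → f (x , y)) ys) xs
∑List-cartesianProduct f [] ys = refl
∑List-cartesianProduct f (x ∷ xs) ys =
  trans (∑List-++ f (map (x ,_) ys) _) (cong₂ _+_ (∑List-map f (x ,_) ys) (∑List-cartesianProduct f xs ys))

solCount-∑ : ∀ a11 a22 a33 a12 a13 a23 d p →
  + solCount a11 a22 a33 a12 a13 a23 d p ≡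
  ∑[ x < p ] ∑[ y < p ] ∑[ z < p ] 𝟙 ((+ p) ∣ℤ? F a11 a22 a33 a12 a13 a23 d (res x) (res y) (res z))
solCount-∑ a11 a22 a33 a12 a13 a23 d p =
  trans (length-filter _ (triples p))
  (trans (∑List-cartesianProduct solution (allFin p) pairs)
  (trans (∑List-tabulate (λ x → ∑List (λ yz → solution (x , yz)) pairs) id)
         (sum-cong-≗ λ x → trans (∑List-cartesianProduct (λ yz → solution (x , yz)) (allFin p) (allFin p))
                          (trans (∑List-tabulate (λ y → ∑List (λ z → solution (x , y , z)) (allFin p)) id)
                                 (sum-cong-≗ λ y → ∑List-tabulate (λ z → solution (x , y , z)) id)))))
  where
  pairs = cartesianProduct (allFin p) (allFin p)
  solution : Fin p × Fin p × Fin p → ℤ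
  solution (x , y , z) = 𝟙 ((+ p) ∣ℤ? F a11 a22 a33 a12 a13 a23 d (res x) (res y) (res z))

-- Congruences modulo m

module Modulo (m : ℕ) where

  infix 4 _≈_ _≉_

  -- A record rather than a synonym for divisibility, so that a and b are inferable from a ≈ b.
  record _≈_ (a b : ℤ) : Set where
    constructor congruent
    field m∣a-b : + m Signed.∣ a - b

  open _≈_ public

  _≉_ : ℤ → ℤ → Set
  a ≉ b = ¬ a ≈ b

  ≈-reflexive : ∀ {a b} → a ≡ b → a ≈ b
  ≈-reflexive {a} refl = congruent (divides 0ℤ (ring a))
    where
    ring : ∀ a → a - a ≡ 0ℤ * + m
    ring = solve-∀

  ≈-refl : ∀ {a} → a ≈ a
  ≈-refl = ≈-reflexive refl

  ≈-sym : ∀ {a b} → a ≈ b → b ≈ a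
  ≈-sym {a} {b} (congruent m∣a-b) = congruent (subst (+ m Signed.∣_) (ring a b) (∣m⇒∣-m m∣a-b))
    where
    ring : ∀ a b → - (a - b) ≡ b - a
    ring = solve-∀

  ≈-trans : ∀ {a b c} → a ≈ b → b ≈ c → a ≈ c
  ≈-trans {a} {b} {c} (congruent m∣a-b) (congruent m∣b-c) =
    congruent (subst (+ m Signed.∣_) (ring a b c) (∣m∣n⇒∣m+n m∣a-b m∣b-c))
    where
    ring : ∀ a b c → a - b + (b - c) ≡ a - c
    ring = solve-∀

  +-cong : ∀ {a b c d} → a ≈ b → c ≈ d → a + c ≈ b + d
  +-cong {a} {b} {c} {d} (congruent m∣a-b) (congruent m∣c-d) =
    congruent (subst (+ m Signed.∣_) (ring a b c d) (∣m∣n⇒∣m+n m∣a-b m∣c-d))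
    where
    ring : ∀ a b c d → a - b + (c - d) ≡ a + c - (b + d)
    ring = solve-∀

  -‿cong : ∀ {a b} → a ≈ b → - a ≈ - b
  -‿cong {a} {b} (congruent m∣a-b) = congruent (subst (+ m Signed.∣_) (ring a b) (∣m⇒∣-m m∣a-b))
    where
    ring : ∀ a b → - (a - b) ≡ - a - - b
    ring = solve-∀

  sub-cong : ∀ {a b c d} → a ≈ b → c ≈ d → a - c ≈ b - d
  sub-cong a≈b c≈d = +-cong a≈b (-‿cong c≈d)

  *-cong : ∀ {a b c d} → a ≈ b → c ≈ d → a * c ≈ b * d
  *-cong {a} {b} {c} {d} (congruent m∣a-b) (congruent m∣c-d) =
    congruent (subst (+ m Signed.∣_) (ring a b c d) (∣m∣n⇒∣m+n (∣m⇒∣m*n c m∣a-b) (∣n⇒∣m*n b m∣c-d)))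
    where
    ring : ∀ a b c d → (a - b) * c + b * (c - d) ≡ a * c - b * d
    ring = solve-∀

  ≈-isEquivalence : IsEquivalence _≈_
  ≈-isEquivalence = record { refl = ≈-refl ; sym = ≈-sym ; trans = ≈-trans }

  ≈-setoid : Setoid 0ℓ 0ℓ
  ≈-setoid = record { isEquivalence = ≈-isEquivalence }

  module ≈-Reasoning = SetoidReasoning ≈-setoid

  ≈0-*ˡ : ∀ a {b} → b ≈ 0ℤ → a * b ≈ 0ℤ
  ≈0-*ˡ a {b} b≈0 = ≈-trans (*-cong (≈-refl {a}) b≈0) (≈-reflexive (*-zeroʳ a))

  ≈0-*ʳ : ∀ {a} b → a ≈ 0ℤ → a * b ≈ 0ℤ
  ≈0-*ʳ {a} b a≈0 = ≈-trans (*-cong a≈0 (≈-refl {b})) (≈-reflexive (*-zeroˡ b))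

  ≈⇒sub≈0 : ∀ {a b} → a ≈ b → a - b ≈ 0ℤ
  ≈⇒sub≈0 {a} {b} (congruent m∣a-b) = congruent (subst (+ m Signed.∣_) (sym (+-identityʳ (a - b))) m∣a-b)

  sub≈0⇒≈ : ∀ {a b} → a - b ≈ 0ℤ → a ≈ b
  sub≈0⇒≈ {a} {b} (congruent m∣a-b-0) = congruent (subst (+ m Signed.∣_) (+-identityʳ (a - b)) m∣a-b-0)

  ≈0⇒∣ : ∀ {a} → a ≈ 0ℤ → + m ∣ a
  ≈0⇒∣ {a} (congruent m∣a-0) = ∣⇒∣ᵤ (subst (+ m Signed.∣_) (+-identityʳ a) m∣a-0)

  ∣⇒≈0 : ∀ {a} → + m ∣ a → a ≈ 0ℤ
  ∣⇒≈0 {a} m∣a = congruent (subst (+ m Signed.∣_) (sym (+-identityʳ a)) (∣ᵤ⇒∣ m∣a))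

  ≉0-factors : ∀ a b c d → ¬ (+ m ∣ a * b * c * d) → a ≉ 0ℤ × b ≉ 0ℤ × c ≉ 0ℤ × d ≉ 0ℤ
  ≉0-factors a b c d m∤abcd =
      (λ a≈0 → m∤abcd (≈0⇒∣ (≈0-*ʳ d (≈0-*ʳ c (≈0-*ʳ b a≈0)))))
    , (λ b≈0 → m∤abcd (≈0⇒∣ (≈0-*ʳ d (≈0-*ʳ c (≈0-*ˡ a b≈0)))))
    , (λ c≈0 → m∤abcd (≈0⇒∣ (≈0-*ʳ d (≈0-*ˡ (a * b) c≈0))))
    , (λ d≈0 → m∤abcd (≈0⇒∣ (≈0-*ˡ (a * b * c) d≈0)))

  infix 4 _≈?0
  _≈?0 : ∀ a → Dec (a ≈ 0ℤ)
  a ≈?0 with (+ m) ∣ℤ? a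
  ... | yes m∣a = yes (∣⇒≈0 m∣a)
  ... | no m∤a = no (m∤a ∘ ≈0⇒∣)

  [_≡0] : ℤ → ℤ
  [ e ≡0] = 𝟙 ((+ m) ∣ℤ? e)

  [≡0]-≈0 : ∀ {e} → e ≈ 0ℤ → [ e ≡0] ≡ 1ℤ
  [≡0]-≈0 {e} e≈0 with (+ m) ∣ℤ? e
  ... | yes _ = refl
  ... | no m∤e = ⊥-elim (m∤e (≈0⇒∣ e≈0))

  [≡0]-≉0 : ∀ {e} → e ≉ 0ℤ → [ e ≡0] ≡ 0ℤ
  [≡0]-≉0 {e} e≉0 with (+ m) ∣ℤ? e
  ... | yes m∣e = ⊥-elim (e≉0 (∣⇒≈0 m∣e))
  ... | no _ = refl

  [≡0]-cong : ∀ {a b} → a ≈ b → [ a ≡0] ≡ [ b ≡0]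
  [≡0]-cong {a} {b} a≈b with a ≈?0
  ... | yes a≈0 = trans ([≡0]-≈0 a≈0) (sym ([≡0]-≈0 (≈-trans (≈-sym a≈b) a≈0)))
  ... | no a≉0 = trans ([≡0]-≉0 a≉0) (sym ([≡0]-≉0 (a≉0 ∘ ≈-trans a≈b)))

  ∑ᵣ : (ℤ → ℤ) → ℤ
  ∑ᵣ h = ∑[ i < m ] h (res i)

  syntax ∑ᵣ (λ x → e) = ∑ᵣ[ x ] e

  ∑ᵣ-cong : ∀ {f g : ℤ → ℤ} → (∀ x → f x ≡ g x) → ∑ᵣ f ≡ ∑ᵣ g
  ∑ᵣ-cong f≗g = sum-cong-≗ {m} (λ i → f≗g (res i))

  ∑ᵣ-+ : ∀ (f g : ℤ → ℤ) → ∑ᵣ[ x ] (f x + g x) ≡ ∑ᵣ f + ∑ᵣ g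
  ∑ᵣ-+ f g = ∑-distrib-+ {m} (f ∘ res) (g ∘ res)

  ∑ᵣ-- : ∀ (f g : ℤ → ℤ) → ∑ᵣ[ x ] (f x - g x) ≡ ∑ᵣ f - ∑ᵣ g
  ∑ᵣ-- f g = ∑-distrib-- {m} (f ∘ res) (g ∘ res)

  ∑ᵣ-*ˡ : ∀ c (f : ℤ → ℤ) → ∑ᵣ[ x ] (c * f x) ≡ c * ∑ᵣ f
  ∑ᵣ-*ˡ c f = sym (*-distribˡ-sum {m} c (f ∘ res))

  ∑ᵣ-*ʳ : ∀ c (f : ℤ → ℤ) → ∑ᵣ[ x ] (f x * c) ≡ ∑ᵣ f * c
  ∑ᵣ-*ʳ c f = sym (*-distribʳ-sum {m} c (f ∘ res))

  ∑ᵣ-const : ∀ c → ∑ᵣ[ x ] c ≡ + m * c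
  ∑ᵣ-const = ∑-const m

  ∑ᵣ-zero : ∀ {f : ℤ → ℤ} → (∀ x → f x ≡ 0ℤ) → ∑ᵣ f ≡ 0ℤ
  ∑ᵣ-zero f≡0 = ∑-zero {m} (λ i → f≡0 (res i))

  ∑ᵣ-comm : ∀ (f : ℤ → ℤ → ℤ) → ∑ᵣ[ x ] ∑ᵣ[ y ] f x y ≡ ∑ᵣ[ y ] ∑ᵣ[ x ] f x y
  ∑ᵣ-comm f = ∑-comm {m} {m} (λ i j → f (res i) (res j))

  solCount-∑ᵣ : ∀ a11 a22 a33 a12 a13 a23 d →
    + solCount a11 a22 a33 a12 a13 a23 d m ≡ ∑ᵣ[ x ] ∑ᵣ[ y ] ∑ᵣ[ z ] [ F a11 a22 a33 a12 a13 a23 d x y z ≡0]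
  solCount-∑ᵣ = λ a11 a22 a33 a12 a13 a23 d → solCount-∑ a11 a22 a33 a12 a13 a23 d m

  F-cong : ∀ {a11 a22 a33 a12 a13 a23 d x y z b11 b22 b33 b12 b13 b23 e x′ y′ z′} →
    a11 ≈ b11 → a22 ≈ b22 → a33 ≈ b33 → a12 ≈ b12 → a13 ≈ b13 → a23 ≈ b23 → d ≈ e →
    x ≈ x′ → y ≈ y′ → z ≈ z′ →
    F a11 a22 a33 a12 a13 a23 d x y z ≈ F b11 b22 b33 b12 b13 b23 e x′ y′ z′
  F-cong ≈11 ≈22 ≈33 ≈12 ≈13 ≈23 ≈d ≈x ≈y ≈z =
    sub-cong (+-cong (+-cong (+-cong (+-cong (+-cong (*-cong (*-cong ≈11 ≈x) ≈x) (*-cong (*-cong ≈22 ≈y) ≈y))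
                                          (*-cong (*-cong ≈33 ≈z) ≈z))
                                   (*-cong (*-cong ≈12 ≈x) ≈y))
                           (*-cong (*-cong ≈13 ≈x) ≈z))
                   (*-cong (*-cong ≈23 ≈y) ≈z))
           (*-cong (*-cong (*-cong ≈d ≈x) ≈y) ≈z)

  solCount-cong : ∀ {a11 a22 a33 a12 a13 a23 d b11 b22 b33 b12 b13 b23 e} →
    a11 ≈ b11 → a22 ≈ b22 → a33 ≈ b33 → a12 ≈ b12 → a13 ≈ b13 → a23 ≈ b23 → d ≈ e →
    + solCount a11 a22 a33 a12 a13 a23 d m ≡ + solCount b11 b22 b33 b12 b13 b23 e m
  solCount-cong {a11} {a22} {a33} {a12} {a13} {a23} {d} {b11} {b22} {b33} {b12} {b13} {b23} {e}
                ≈11 ≈22 ≈33 ≈12 ≈13 ≈23 ≈d =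
    trans (solCount-∑ᵣ a11 a22 a33 a12 a13 a23 d)
   (trans (∑ᵣ-cong λ x → ∑ᵣ-cong λ y → ∑ᵣ-cong λ z →
             [≡0]-cong (F-cong ≈11 ≈22 ≈33 ≈12 ≈13 ≈23 ≈d (≈-refl {x}) (≈-refl {y}) (≈-refl {z})))
          (sym (solCount-∑ᵣ b11 b22 b33 b12 b13 b23 e)))

  module _ .{{_ : NonZero m}} where

    reduce : ℤ → Fin m
    reduce a = fromℕ< (n%ℕd<d a m)

    res-reduce : ∀ a → res (reduce a) ≈ a
    res-reduce a = congruent (divides (- (a /ℕ m)) (begin
      res (reduce a) - a                               ≡⟨ cong (λ r → + r - a) (toℕ-fromℕ< (n%ℕd<d a m)) ⟩
      + (a %ℕ m) - a                                   ≡⟨ cong (λ b → + (a %ℕ m) - b) (a≡a%ℕn+[a/ℕn]*n a m) ⟩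
      + (a %ℕ m) - (+ (a %ℕ m) + a /ℕ m * + m)        ≡⟨ ring (+ (a %ℕ m)) (a /ℕ m) (+ m) ⟩
      - (a /ℕ m) * + m                                 ∎))
      where
      open ≡-Reasoning
      ring : ∀ r q m → r - (r + q * m) ≡ - q * m
      ring = solve-∀

    res-injective : ∀ {i j : Fin m} → res i ≈ res j → i ≡ j
    res-injective {i} {j} i≈j = toℕ-injective (+-injective (difference≡0 (∣i∣≡0⇒i≡0 ∣difference∣≡0)))
      where
      difference = + toℕ i - + toℕ j
      ∣difference∣<m : ∣ difference ∣ ℕ.< m
      ∣difference∣<m = ℕ.≤-<-trans
        (subst (ℕ._≤ toℕ i ℕ.⊔ toℕ j) (cong ∣_∣ (sym (m-n≡m⊖n (toℕ i) (toℕ j)))) (∣m⊝n∣≤m⊔n (toℕ i) (toℕ j)))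
        (ℕ.⊔-lub (toℕ<n i) (toℕ<n j))
      ∣difference∣≡0 : ∣ difference ∣ ≡ 0
      ∣difference∣≡0 with ∣ difference ∣ | ∣⇒∣ᵤ (m∣a-b i≈j) | ∣difference∣<m
      ... | zero | _ | _ = refl
      ... | suc _ | m∣n | n<m = ⊥-elim (>⇒∤ n<m m∣n)
      difference≡0 : difference ≡ 0ℤ → + toℕ i ≡ + toℕ j
      difference≡0 eq = trans (ring (+ toℕ i) (+ toℕ j)) (cong (_+ + toℕ j) eq)
        where
        ring : ∀ a b → a ≡ a - b + b
        ring = solve-∀

    ∑ᵣ-[≡0]-* : ∀ (h : ℤ → ℤ) → h Preserves _≈_ ⟶ _≡_ → ∑ᵣ[ x ] ([ x ≡0] * h x) ≡ h 0ℤ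
    ∑ᵣ-[≡0]-* h h-cong = begin
      ∑ᵣ[ x ] ([ x ≡0] * h x)    ≡⟨ ∑-single _ origin off-origin ⟩
      [ res origin ≡0] * h (res origin) ≡⟨ cong₂ _*_ ([≡0]-≈0 origin≈0) (h-cong origin≈0) ⟩
      1ℤ * h 0ℤ                  ≡⟨ *-identityˡ (h 0ℤ) ⟩
      h 0ℤ                       ∎
      where
      open ≡-Reasoning
      origin = reduce 0ℤ
      origin≈0 = res-reduce 0ℤ
      off-origin : ∀ i → i ≢ origin → [ res i ≡0] * h (res i) ≡ 0ℤ
      off-origin i i≢origin = trans
        (cong (_* h (res i)) ([≡0]-≉0 (λ i≈0 → i≢origin (res-injective (≈-trans i≈0 (≈-sym origin≈0))))))
        (*-zeroˡ (h (res i)))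

    ∑ᵣ-[≡0] : ∑ᵣ[ x ] [ x ≡0] ≡ 1ℤ
    ∑ᵣ-[≡0] = trans (∑ᵣ-cong (λ x → sym (*-identityʳ [ x ≡0]))) (∑ᵣ-[≡0]-* (λ _ → 1ℤ) (λ _ → refl))

    ∑ᵣ-units : ∑ᵣ[ x ] (1ℤ - [ x ≡0]) ≡ + m - 1ℤ
    ∑ᵣ-units = trans (∑ᵣ-- (λ _ → 1ℤ) [_≡0]) (cong₂ _-_ (trans (∑ᵣ-const 1ℤ) (*-identityʳ (+ m))) ∑ᵣ-[≡0])

    ∑ᵣ-by-zero : ∀ (f : ℤ → ℤ) A U → (∀ {x} → x ≈ 0ℤ → f x ≡ A) → (∀ {x} → x ≉ 0ℤ → f x ≡ U) →
      ∑ᵣ f ≡ A + (+ m - 1ℤ) * U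
    ∑ᵣ-by-zero f A U at-0 off-0 = begin
      ∑ᵣ f                                            ≡⟨ ∑ᵣ-cong select ⟩
      ∑ᵣ[ x ] ([ x ≡0] * A + (1ℤ - [ x ≡0]) * U)      ≡⟨ ∑ᵣ-+ (λ x → [ x ≡0] * A) (λ x → (1ℤ - [ x ≡0]) * U) ⟩
      ∑ᵣ[ x ] ([ x ≡0] * A) + ∑ᵣ[ x ] ((1ℤ - [ x ≡0]) * U)
                                                      ≡⟨ cong₂ _+_ (∑ᵣ-[≡0]-* (λ _ → A) (λ _ → refl))
                                                                   (trans (∑ᵣ-*ʳ U (λ x → 1ℤ - [ x ≡0])) (cong (_* U) ∑ᵣ-units)) ⟩
      A + (+ m - 1ℤ) * U                              ∎
      where
      open ≡-Reasoning
      select : ∀ x → f x ≡ [ x ≡0] * A + (1ℤ - [ x ≡0]) * U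
      select x with x ≈?0
      ... | yes x≈0 = trans (at-0 x≈0) (trans (ring A U) (sym (cong (λ t → t * A + (1ℤ - t) * U) ([≡0]-≈0 x≈0))))
        where
        ring : ∀ A U → A ≡ 1ℤ * A + (1ℤ - 1ℤ) * U
        ring = solve-∀
      ... | no x≉0 = trans (off-0 x≉0) (trans (ring A U) (sym (cong (λ t → t * A + (1ℤ - t) * U) ([≡0]-≉0 x≉0))))
        where
        ring : ∀ A U → U ≡ 0ℤ * A + (1ℤ - 0ℤ) * U
        ring = solve-∀

-- The case p = 2

module Parity where

  open Modulo 2

  data Parity (a : ℤ) : Fin 2 → Set where
    even : + 2 ∣ a → Parity a 0F
    odd : ¬ (+ 2 ∣ a) → a ≈ 1ℤ → Parity a 1F

  parity : ∀ a → Parity a (reduce a)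
  parity a with reduce a | res-reduce a
  ... | 0F | 0≈a = even (≈0⇒∣ (≈-sym 0≈a))
  ... | 1F | 1≈a = odd (λ 2∣a → >⇒∤ (ℕ.s≤s (ℕ.s≤s ℕ.z≤n)) (≈0⇒∣ (≈-trans 1≈a (∣⇒≈0 2∣a)))) (≈-sym 1≈a)

  ≉0⇒≈1 : ∀ {a} → a ≉ 0ℤ → a ≈ 1ℤ
  ≉0⇒≈1 {a} a≉0 with reduce a | parity a
  ... | 0F | even 2∣a = ⊥-elim (a≉0 (∣⇒≈0 2∣a))
  ... | 1F | odd _ a≈1 = a≈1

  detG-even : ∀ a11 a22 a33 a12 a13 a23 → + 2 ∣ detG a11 a22 a33 a12 a13 a23
  detG-even a11 a22 a33 a12 a13 a23 = ∣⇒∣ᵤ (divides half (ring a11 a22 a33 a12 a13 a23))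
    where
    half = + 4 * a11 * a22 * a33 - a11 * a23 * a23 - a12 * a12 * a33 + a12 * a23 * a13 - a22 * a13 * a13
    ring : ∀ a11 a22 a33 a12 a13 a23 →
      (+ 2 * a11) * ((+ 2 * a22) * (+ 2 * a33) - a23 * a23) - a12 * (a12 * (+ 2 * a33) - a23 * a13)
        + a13 * (a12 * a23 - (+ 2 * a22) * a13) ≡
      (+ 4 * a11 * a22 * a33 - a11 * a23 * a23 - a12 * a12 * a33 + a12 * a23 * a13 - a22 * a13 * a13) * + 2
    ring = solve-∀

  parity-count : Fin 2 → Fin 2 → Fin 2 → ℤ
  parity-count 0F 0F 0F = + 5
  parity-count 1F 1F 1F = + 1
  parity-count _ _ _ = + 3

  solCount-parity : ∀ b12 b13 b23 →
    + solCount 1ℤ 1ℤ 1ℤ (res b12) (res b13) (res b23) 1ℤ 2 ≡ parity-count b12 b13 b23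
  solCount-parity 0F 0F 0F = refl
  solCount-parity 0F 0F 1F = refl
  solCount-parity 0F 1F 0F = refl
  solCount-parity 0F 1F 1F = refl
  solCount-parity 1F 0F 0F = refl
  solCount-parity 1F 0F 1F = refl
  solCount-parity 1F 1F 0F = refl
  solCount-parity 1F 1F 1F = refl

  parity-count-even : ∀ {a12 a13 a23} → (+ 2 ∣ a12) × (+ 2 ∣ a13) × (+ 2 ∣ a23) →
    parity-count (reduce a12) (reduce a13) (reduce a23) ≡ + 5
  parity-count-even {a12} {a13} {a23} (e12 , e13 , e23)
    with reduce a12 | parity a12 | reduce a13 | parity a13 | reduce a23 | parity a23
  ... | 0F | _ | 0F | _ | 0F | _ = refl
  ... | 1F | odd o12 _ | _ | _ | _ | _ = ⊥-elim (o12 e12)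
  ... | _ | _ | 1F | odd o13 _ | _ | _ = ⊥-elim (o13 e13)
  ... | _ | _ | _ | _ | 1F | odd o23 _ = ⊥-elim (o23 e23)

  parity-count-odd : ∀ {a12 a13 a23} → ¬ (+ 2 ∣ a12) × ¬ (+ 2 ∣ a13) × ¬ (+ 2 ∣ a23) →
    parity-count (reduce a12) (reduce a13) (reduce a23) ≡ + 1
  parity-count-odd {a12} {a13} {a23} (o12 , o13 , o23)
    with reduce a12 | parity a12 | reduce a13 | parity a13 | reduce a23 | parity a23
  ... | 1F | _ | 1F | _ | 1F | _ = refl
  ... | 0F | even e12 | _ | _ | _ | _ = ⊥-elim (o12 e12)
  ... | _ | _ | 0F | even e13 | _ | _ = ⊥-elim (o13 e13)
  ... | _ | _ | _ | _ | 0F | even e23 = ⊥-elim (o23 e23)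

  parity-count-mixed : ∀ {a12 a13 a23} →
    ¬ ((+ 2 ∣ a12) × (+ 2 ∣ a13) × (+ 2 ∣ a23)) → ¬ (¬ (+ 2 ∣ a12) × ¬ (+ 2 ∣ a13) × ¬ (+ 2 ∣ a23)) →
    parity-count (reduce a12) (reduce a13) (reduce a23) ≡ + 3
  parity-count-mixed {a12} {a13} {a23} ¬even ¬odd
    with reduce a12 | parity a12 | reduce a13 | parity a13 | reduce a23 | parity a23
  ... | 0F | even e12 | 0F | even e13 | 0F | even e23 = ⊥-elim (¬even (e12 , e13 , e23))
  ... | 0F | _ | 0F | _ | 1F | _ = refl
  ... | 0F | _ | 1F | _ | 0F | _ = refl
  ... | 0F | _ | 1F | _ | 1F | _ = refl
  ... | 1F | _ | 0F | _ | 0F | _ = refl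
  ... | 1F | _ | 0F | _ | 1F | _ = refl
  ... | 1F | _ | 1F | _ | 0F | _ = refl
  ... | 1F | odd o12 _ | 1F | odd o13 _ | 1F | odd o23 _ = ⊥-elim (¬odd (o12 , o13 , o23))

  module Count (a11 a22 a33 a12 a13 a23 d : ℤ) (a11≉0 : a11 ≉ 0ℤ) (a22≉0 : a22 ≉ 0ℤ) (a33≉0 : a33 ≉ 0ℤ) (d≉0 : d ≉ 0ℤ) where

    solCount-reduce : + solCount a11 a22 a33 a12 a13 a23 d 2 ≡ parity-count (reduce a12) (reduce a13) (reduce a23)
    solCount-reduce = trans
      (solCount-cong (≉0⇒≈1 a11≉0) (≉0⇒≈1 a22≉0) (≉0⇒≈1 a33≉0)
        (≈-sym (res-reduce a12)) (≈-sym (res-reduce a13)) (≈-sym (res-reduce a23)) (≉0⇒≈1 d≉0))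
      (solCount-parity (reduce a12) (reduce a13) (reduce a23))

    count-all-even : (+ 2 ∣ a12) × (+ 2 ∣ a13) × (+ 2 ∣ a23) → + solCount a11 a22 a33 a12 a13 a23 d 2 ≡ + 5
    count-all-even all-even = trans solCount-reduce (parity-count-even {a12} {a13} {a23} all-even)

    count-all-odd : ¬ (+ 2 ∣ a12) × ¬ (+ 2 ∣ a13) × ¬ (+ 2 ∣ a23) → + solCount a11 a22 a33 a12 a13 a23 d 2 ≡ + 1
    count-all-odd all-odd = trans solCount-reduce (parity-count-odd {a12} {a13} {a23} all-odd)

    count-mixed : ¬ ((+ 2 ∣ a12) × (+ 2 ∣ a13) × (+ 2 ∣ a23)) → ¬ (¬ (+ 2 ∣ a12) × ¬ (+ 2 ∣ a13) × ¬ (+ 2 ∣ a23)) →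
      + solCount a11 a22 a33 a12 a13 a23 d 2 ≡ + 3
    count-mixed ¬even ¬odd = trans solCount-reduce (parity-count-mixed {a12} {a13} {a23} ¬even ¬odd)

module OddPrime (p : ℕ) (p-prime : Prime p) (2<p : 2 < p) where

  instance
    p-nonZero : NonZero p
    p-nonZero = prime⇒nonZero p-prime

  open Modulo p public

  euclid : ∀ {a b} → a * b ≈ 0ℤ → a ≈ 0ℤ ⊎ b ≈ 0ℤ
  euclid {a} {b} ab≈0 with euclidsLemma ∣ a ∣ ∣ b ∣ p-prime (subst (p ∣ℕ_) (abs-* a b) (≈0⇒∣ ab≈0))
  ... | inj₁ p∣a = inj₁ (∣⇒≈0 p∣a)
  ... | inj₂ p∣b = inj₂ (∣⇒≈0 p∣b)

  ≉0-* : ∀ {a b} → a ≉ 0ℤ → b ≉ 0ℤ → a * b ≉ 0ℤ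
  ≉0-* a≉0 b≉0 ab≈0 with euclid ab≈0
  ... | inj₁ a≈0 = a≉0 a≈0
  ... | inj₂ b≈0 = b≉0 b≈0

  ≉0-cancelˡ : ∀ {a b} → a ≉ 0ℤ → a * b ≈ 0ℤ → b ≈ 0ℤ
  ≉0-cancelˡ a≉0 ab≈0 with euclid ab≈0
  ... | inj₁ a≈0 = ⊥-elim (a≉0 a≈0)
  ... | inj₂ b≈0 = b≈0

  ≉0-neg : ∀ {a} → a ≉ 0ℤ → - a ≉ 0ℤ
  ≉0-neg a≉0 -a≈0 = a≉0 (≈-trans (≈-reflexive (sym (neg-involutive _))) (-‿cong -a≈0))

  square-≈0⇒≈0 : ∀ {c} → c * c ≈ 0ℤ → c ≈ 0ℤ
  square-≈0⇒≈0 c²≈0 with euclid c²≈0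
  ... | inj₁ c≈0 = c≈0
  ... | inj₂ c≈0 = c≈0

  1≉0 : 1ℤ ≉ 0ℤ
  1≉0 1≈0 = >⇒∤ (ℕ.≤-trans (ℕ.s≤s (ℕ.s≤s ℕ.z≤n)) 2<p) (≈0⇒∣ 1≈0)

  2≉0 : + 2 ≉ 0ℤ
  2≉0 2≈0 = >⇒∤ 2<p (≈0⇒∣ 2≈0)

  4≉0 : + 4 ≉ 0ℤ
  4≉0 = ≉0-* 2≉0 2≉0

  inverse-ℕ : ∀ n → + n ≉ 0ℤ → ∃ λ b → + n * b ≈ 1ℤ
  inverse-ℕ n n≉0 with coprime-Bézout coprime
    where
    coprime : Coprime n p
    coprime (d∣n , d∣p) with prime⇒irreducible p-prime d∣p
    ... | inj₁ d≡1 = d≡1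
    ... | inj₂ refl = ⊥-elim (n≉0 (∣⇒≈0 d∣n))
  ... | GCD.Bézout.+- x y eq = + x , congruent (divides (+ y) (begin
    + n * + x - 1ℤ             ≡⟨ cong (_- 1ℤ) (trans (sym (pos-* n x)) (cong +_ (trans (ℕ.*-comm n x) (sym eq)))) ⟩
    + (1 ℕ.+ y ℕ.* p) - 1ℤ     ≡⟨ cong (_- 1ℤ) (trans (pos-+ 1 (y ℕ.* p)) (cong (_+_ 1ℤ) (pos-* y p))) ⟩
    1ℤ + + y * + p - 1ℤ        ≡⟨ ring (+ y * + p) ⟩
    + y * + p                  ∎))
    where
    open ≡-Reasoning
    ring : ∀ a → 1ℤ + a - 1ℤ ≡ a
    ring = solve-∀
  ... | GCD.Bézout.-+ x y eq = - + x , congruent (divides (- + y) (begin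
    + n * - + x - 1ℤ           ≡⟨ ring (+ n) (+ x) ⟩
    - (1ℤ + + x * + n)         ≡⟨ cong -_ (trans (cong (_+_ 1ℤ) (sym (pos-* x n))) (trans (sym (pos-+ 1 (x ℕ.* n))) (cong +_ eq))) ⟩
    - + (y ℕ.* p)              ≡⟨ cong -_ (pos-* y p) ⟩
    - (+ y * + p)              ≡⟨ neg-distribˡ-* (+ y) (+ p) ⟩
    - + y * + p                ∎))
    where
    open ≡-Reasoning
    ring : ∀ n x → n * - x - 1ℤ ≡ - (1ℤ + x * n)
    ring = solve-∀

  inverse : ∀ {a} → a ≉ 0ℤ → ∃ λ b → a * b ≈ 1ℤ
  inverse {+ n} = inverse-ℕ n
  inverse { -[1+ n ]} a≉0 with inverse-ℕ (suc n) (a≉0 ∘ -‿cong)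
  ... | b , nb≈1 = - b , ≈-trans (≈-reflexive (ring (+ suc n) b)) nb≈1
    where
    ring : ∀ n b → - n * - b ≡ n * b
    ring = solve-∀

  affine-permutation : ∀ {m} → m ≉ 0ℤ → ℤ → Permutation p p
  affine-permutation {m} m≉0 c = permutation
    (λ i → reduce (m * res i + c))
    (λ j → reduce (m⁻¹ * (res j - c)))
    (λ j → res-injective (≈-trans (res-reduce _) (inverse-law (res j))))
    (λ i → res-injective (≈-trans (res-reduce _) (inverse-law′ (res i))))
    where
    open ≈-Reasoning
    m⁻¹ = proj₁ (inverse m≉0)
    mm⁻¹≈1 = proj₂ (inverse m≉0)
    inverse-law : ∀ y → m * res (reduce (m⁻¹ * (y - c))) + c ≈ y
    inverse-law y = begin
      m * res (reduce (m⁻¹ * (y - c))) + c  ≈⟨ +-cong (*-cong (≈-refl {m}) (res-reduce (m⁻¹ * (y - c)))) (≈-refl {c}) ⟩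
      m * (m⁻¹ * (y - c)) + c               ≈⟨ ≈-reflexive (ring m m⁻¹ y c) ⟩
      m * m⁻¹ * (y - c) + c                 ≈⟨ +-cong (*-cong mm⁻¹≈1 (≈-refl {y - c})) (≈-refl {c}) ⟩
      1ℤ * (y - c) + c                      ≈⟨ ≈-reflexive (ring′ y c) ⟩
      y                                     ∎
      where
      ring : ∀ m m⁻¹ y c → m * (m⁻¹ * (y - c)) + c ≡ m * m⁻¹ * (y - c) + c
      ring = solve-∀
      ring′ : ∀ y c → 1ℤ * (y - c) + c ≡ y
      ring′ = solve-∀
    inverse-law′ : ∀ x → m⁻¹ * (res (reduce (m * x + c)) - c) ≈ x
    inverse-law′ x = begin
      m⁻¹ * (res (reduce (m * x + c)) - c)  ≈⟨ *-cong (≈-refl {m⁻¹}) (sub-cong (res-reduce (m * x + c)) (≈-refl {c})) ⟩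
      m⁻¹ * (m * x + c - c)                 ≈⟨ ≈-reflexive (ring m m⁻¹ x c) ⟩
      m * m⁻¹ * x                           ≈⟨ *-cong mm⁻¹≈1 (≈-refl {x}) ⟩
      1ℤ * x                                ≈⟨ ≈-reflexive (*-identityˡ x) ⟩
      x                                     ∎
      where
      ring : ∀ m m⁻¹ x c → m⁻¹ * (m * x + c - c) ≡ m * m⁻¹ * x
      ring = solve-∀

  ∑ᵣ-affine : ∀ {m} c (h : ℤ → ℤ) → m ≉ 0ℤ → h Preserves _≈_ ⟶ _≡_ → ∑ᵣ[ x ] h (m * x + c) ≡ ∑ᵣ h
  ∑ᵣ-affine {m} c h m≉0 h-cong = begin
    ∑ᵣ[ x ] h (m * x + c)                   ≡⟨ ∑ᵣ-cong (λ x → h-cong (≈-sym (res-reduce (m * x + c)))) ⟩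
    ∑[ i < p ] h (res (reduce (m * res i + c))) ≡⟨ sym (sum-permute (h ∘ res) (affine-permutation m≉0 c)) ⟩
    ∑ᵣ h                                    ∎
    where open ≡-Reasoning

  ∑ᵣ-scale : ∀ {t} (h : ℤ → ℤ) → t ≉ 0ℤ → h Preserves _≈_ ⟶ _≡_ → ∑ᵣ[ x ] h (t * x) ≡ ∑ᵣ h
  ∑ᵣ-scale {t} h t≉0 h-cong = trans (∑ᵣ-cong (λ x → cong h (sym (+-identityʳ (t * x))))) (∑ᵣ-affine 0ℤ h t≉0 h-cong)

  linear-root-count : ∀ {m} c → m ≉ 0ℤ → ∑ᵣ[ x ] [ m * x + c ≡0] ≡ 1ℤ
  linear-root-count c m≉0 = trans (∑ᵣ-affine c [_≡0] m≉0 [≡0]-cong) ∑ᵣ-[≡0]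

  [≡0]-*-≉0 : ∀ {a} b → a ≉ 0ℤ → [ a * b ≡0] ≡ [ b ≡0]
  [≡0]-*-≉0 {a} b a≉0 with b ≈?0
  ... | yes b≈0 = trans ([≡0]-≈0 (≈0-*ˡ a b≈0)) (sym ([≡0]-≈0 b≈0))
  ... | no b≉0 = trans ([≡0]-≉0 (≉0-* a≉0 b≉0)) (sym ([≡0]-≉0 b≉0))

  [≡0]-* : ∀ a b → [ a * b ≡0] ≡ [ a ≡0] + [ b ≡0] - [ a ≡0] * [ b ≡0]
  [≡0]-* a b with a ≈?0
  ... | yes a≈0 = trans ([≡0]-≈0 (≈0-*ʳ b a≈0)) (trans (ring [ b ≡0]) (cong either (sym ([≡0]-≈0 a≈0))))
    where
    either = λ u → u + [ b ≡0] - u * [ b ≡0]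
    ring : ∀ v → 1ℤ ≡ 1ℤ + v - 1ℤ * v
    ring = solve-∀
  ... | no a≉0 = trans ([≡0]-*-≉0 b a≉0) (trans (ring [ b ≡0]) (cong either (sym ([≡0]-≉0 a≉0))))
    where
    either = λ u → u + [ b ≡0] - u * [ b ≡0]
    ring : ∀ v → v ≡ 0ℤ + v - 0ℤ * v
    ring = solve-∀

  [≡0]-square : ∀ a → [ a * a ≡0] ≡ [ a ≡0]
  [≡0]-square a with a ≈?0
  ... | yes a≈0 = trans ([≡0]-≈0 (≈0-*ʳ a a≈0)) (sym ([≡0]-≈0 a≈0))
  ... | no a≉0 = trans ([≡0]-≉0 (≉0-* a≉0 a≉0)) (sym ([≡0]-≉0 a≉0))

  [≡0]-disjoint : ∀ {a b} → ¬ (a ≈ 0ℤ × b ≈ 0ℤ) → [ a * b ≡0] ≡ [ a ≡0] + [ b ≡0]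
  [≡0]-disjoint {a} {b} not-both with a ≈?0 | b ≈?0
  ... | yes a≈0 | yes b≈0 = ⊥-elim (not-both (a≈0 , b≈0))
  ... | yes a≈0 | no b≉0 = trans ([≡0]-≈0 (≈0-*ʳ b a≈0)) (sym (cong₂ _+_ ([≡0]-≈0 a≈0) ([≡0]-≉0 b≉0)))
  ... | no a≉0 | yes b≈0 = trans ([≡0]-≈0 (≈0-*ˡ a b≈0)) (sym (cong₂ _+_ ([≡0]-≉0 a≉0) ([≡0]-≈0 b≈0)))
  ... | no a≉0 | no b≉0 = trans ([≡0]-≉0 (≉0-* a≉0 b≉0)) (sym (cong₂ _+_ ([≡0]-≉0 a≉0) ([≡0]-≉0 b≉0)))

  -- The Legendre symbol and character sums

  χ : ℤ → ℤ
  χ a = legendre a p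

  IsSquare : ℤ → Set
  IsSquare a = ∃ λ r → r * r ≈ a

  data Legendre (a : ℤ) : ℤ → Set where
    divisible : a ≈ 0ℤ → Legendre a 0ℤ
    residue : a ≉ 0ℤ → IsSquare a → Legendre a 1ℤ
    nonresidue : ¬ IsSquare a → Legendre a -1ℤ

  legendre-view : ∀ a → Legendre a (χ a)
  legendre-view a with (+ p) ∣ℤ? a
  ... | yes p∣a = divisible (∣⇒≈0 p∣a)
  ... | no p∤a with any? {n = p} (λ x → (+ p) ∣ℤ? (res x * res x - a))
  ...   | yes (x , p∣x²-a) = residue (p∤a ∘ ≈0⇒∣) (res x , sub≈0⇒≈ (∣⇒≈0 p∣x²-a))
  ...   | no no-root = nonresidue λ (r , r²≈a) →
    no-root (reduce r , ≈0⇒∣ (≈⇒sub≈0 (≈-trans (*-cong (res-reduce r) (res-reduce r)) r²≈a)))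

  χ-≈0 : ∀ {a} → a ≈ 0ℤ → χ a ≡ 0ℤ
  χ-≈0 {a} a≈0 with χ a | legendre-view a
  ... | _ | divisible _ = refl
  ... | _ | residue a≉0 _ = ⊥-elim (a≉0 a≈0)
  ... | _ | nonresidue nonsquare = ⊥-elim (nonsquare (0ℤ , ≈-sym a≈0))

  χ-residue : ∀ {a} → a ≉ 0ℤ → IsSquare a → χ a ≡ 1ℤ
  χ-residue {a} a≉0 square with χ a | legendre-view a
  ... | _ | divisible a≈0 = ⊥-elim (a≉0 a≈0)
  ... | _ | residue _ _ = refl
  ... | _ | nonresidue nonsquare = ⊥-elim (nonsquare square)

  χ-nonresidue : ∀ {a} → ¬ IsSquare a → χ a ≡ -1ℤ
  χ-nonresidue {a} nonsquare with χ a | legendre-view a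
  ... | _ | divisible a≈0 = ⊥-elim (nonsquare (0ℤ , ≈-sym a≈0))
  ... | _ | residue _ square = ⊥-elim (nonsquare square)
  ... | _ | nonresidue _ = refl

  χ-cong : χ Preserves _≈_ ⟶ _≡_
  χ-cong {a} {b} a≈b with χ a | legendre-view a
  ... | _ | divisible a≈0 = sym (χ-≈0 (≈-trans (≈-sym a≈b) a≈0))
  ... | _ | residue a≉0 (r , r²≈a) = sym (χ-residue (a≉0 ∘ ≈-trans a≈b) (r , ≈-trans r²≈a a≈b))
  ... | _ | nonresidue nonsquare = sym (χ-nonresidue (λ (r , r²≈b) → nonsquare (r , ≈-trans r²≈b (≈-sym a≈b))))

  χ-square : ∀ {s} → s ≉ 0ℤ → χ (s * s) ≡ 1ℤ
  χ-square {s} s≉0 = χ-residue (≉0-* s≉0 s≉0) (s , ≈-refl)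

  χ≤1 : ∀ a → χ a ≤ 1ℤ
  χ≤1 a with χ a | legendre-view a
  ... | _ | divisible _ = +≤+ ℕ.z≤n
  ... | _ | residue _ _ = ≤-refl
  ... | _ | nonresidue _ = -≤+

  square-root-count : ∀ a → ∑ᵣ[ x ] [ x * x - a ≡0] ≡ 1ℤ + χ a
  square-root-count a with χ a | legendre-view a
  ... | _ | divisible a≈0 = trans (∑ᵣ-cong root-of-square) ∑ᵣ-[≡0]
    where
    root-of-square : ∀ x → [ x * x - a ≡0] ≡ [ x ≡0]
    root-of-square x = trans ([≡0]-cong (≈-trans (sub-cong (≈-refl {x * x}) a≈0) (≈-reflexive (+-identityʳ (x * x)))))
                             ([≡0]-square x)
  ... | _ | residue a≉0 (r , r²≈a) = begin
    ∑ᵣ[ x ] [ x * x - a ≡0]                           ≡⟨ ∑ᵣ-cong two-roots ⟩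
    ∑ᵣ[ x ] ([ 1ℤ * x + - r ≡0] + [ 1ℤ * x + r ≡0])   ≡⟨ ∑ᵣ-+ (λ x → [ 1ℤ * x + - r ≡0]) (λ x → [ 1ℤ * x + r ≡0]) ⟩
    ∑ᵣ[ x ] [ 1ℤ * x + - r ≡0] + ∑ᵣ[ x ] [ 1ℤ * x + r ≡0] ≡⟨ cong₂ _+_ (linear-root-count (- r) 1≉0) (linear-root-count r 1≉0) ⟩
    1ℤ + 1ℤ                                           ∎
    where
    open ≡-Reasoning
    r≉0 : r ≉ 0ℤ
    r≉0 r≈0 = a≉0 (≈-trans (≈-sym r²≈a) (≈0-*ʳ r r≈0))
    two-roots : ∀ x → [ x * x - a ≡0] ≡ [ 1ℤ * x + - r ≡0] + [ 1ℤ * x + r ≡0]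
    two-roots x = trans ([≡0]-cong (≈-trans (sub-cong (≈-refl {x * x}) (≈-sym r²≈a)) (≈-reflexive (ring x r))))
                        ([≡0]-disjoint λ (x-r≈0 , x+r≈0) → ≉0-* 2≉0 r≉0
                          (≈-trans (≈-reflexive (ring′ x r)) (sub-cong {1ℤ * x + r} {0ℤ} {1ℤ * x + - r} {0ℤ} x+r≈0 x-r≈0)))
      where
      ring : ∀ x r → x * x - r * r ≡ (1ℤ * x + - r) * (1ℤ * x + r)
      ring = solve-∀
      ring′ : ∀ x r → + 2 * r ≡ 1ℤ * x + r - (1ℤ * x + - r)
      ring′ = solve-∀
  ... | _ | nonresidue nonsquare = ∑ᵣ-zero λ x → [≡0]-≉0 λ x²-a≈0 → nonsquare (x , sub≈0⇒≈ x²-a≈0)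

  χ-as-count : ∀ a → χ a ≡ ∑ᵣ[ x ] [ x * x - a ≡0] - 1ℤ
  χ-as-count a = trans (ring (χ a)) (cong (_- 1ℤ) (sym (square-root-count a)))
    where
    ring : ∀ t → t ≡ 1ℤ + t - 1ℤ
    ring = solve-∀

  quadratic-root-count : ∀ {a} b c → a ≉ 0ℤ →
    ∑ᵣ[ x ] [ a * x * x + b * x + c ≡0] ≡ 1ℤ + χ (b * b - + 4 * a * c)
  quadratic-root-count {a} b c a≉0 = begin
    ∑ᵣ[ x ] [ a * x * x + b * x + c ≡0]                  ≡⟨ ∑ᵣ-cong complete-square ⟩
    ∑ᵣ[ x ] [ (+ 2 * a * x + b) * (+ 2 * a * x + b) - Δ ≡0] ≡⟨ ∑ᵣ-affine b (λ u → [ u * u - Δ ≡0]) (≉0-* 2≉0 a≉0)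
                                                                 (λ u≈v → [≡0]-cong (sub-cong (*-cong u≈v u≈v) (≈-refl {Δ}))) ⟩
    ∑ᵣ[ u ] [ u * u - Δ ≡0]                              ≡⟨ square-root-count Δ ⟩
    1ℤ + χ Δ                                             ∎
    where
    open ≡-Reasoning
    Δ = b * b - + 4 * a * c
    complete-square : ∀ x → [ a * x * x + b * x + c ≡0] ≡ [ (+ 2 * a * x + b) * (+ 2 * a * x + b) - Δ ≡0]
    complete-square x = trans (sym ([≡0]-*-≉0 _ (≉0-* 4≉0 a≉0))) (cong [_≡0] (ring a b c x))
      where
      ring : ∀ a b c x → + 4 * a * (a * x * x + b * x + c) ≡ (+ 2 * a * x + b) * (+ 2 * a * x + b) - (b * b - + 4 * a * c)
      ring = solve-∀

  ∑ᵣ-[c·z²≡0] : ∀ {c} → c ≉ 0ℤ → ∑ᵣ[ z ] [ c * (z * z) ≡0] ≡ 1ℤ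
  ∑ᵣ-[c·z²≡0] c≉0 = trans (∑ᵣ-cong (λ z → trans ([≡0]-*-≉0 (z * z) c≉0) ([≡0]-square z))) ∑ᵣ-[≡0]

  ∑ᵣ-χ : ∑ᵣ χ ≡ 0ℤ
  ∑ᵣ-χ = begin
    ∑ᵣ χ                                           ≡⟨ ∑ᵣ-cong χ-as-count ⟩
    ∑ᵣ[ a ] (∑ᵣ[ x ] [ x * x - a ≡0] - 1ℤ)         ≡⟨ ∑ᵣ-- (λ a → ∑ᵣ[ x ] [ x * x - a ≡0]) (λ _ → 1ℤ) ⟩
    ∑ᵣ[ a ] ∑ᵣ[ x ] [ x * x - a ≡0] - ∑ᵣ[ _ ] 1ℤ   ≡⟨ cong (_- ∑ᵣ[ _ ] 1ℤ) (∑ᵣ-comm (λ a x → [ x * x - a ≡0])) ⟩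
    ∑ᵣ[ x ] ∑ᵣ[ a ] [ x * x - a ≡0] - ∑ᵣ[ _ ] 1ℤ   ≡⟨ cong (_- ∑ᵣ[ _ ] 1ℤ) (∑ᵣ-cong one-value) ⟩
    ∑ᵣ[ _ ] 1ℤ - ∑ᵣ[ _ ] 1ℤ                        ≡⟨ +-inverseʳ (∑ᵣ[ _ ] 1ℤ) ⟩
    0ℤ                                             ∎
    where
    open ≡-Reasoning
    one-value : ∀ x → ∑ᵣ[ a ] [ x * x - a ≡0] ≡ 1ℤ
    one-value x = trans (∑ᵣ-cong (λ a → cong [_≡0] (ring x a))) (linear-root-count (x * x) (≉0-neg 1≉0))
      where
      ring : ∀ x a → x * x - a ≡ - 1ℤ * a + x * x
      ring = solve-∀

  χ-square-*-≉0 : ∀ {s} a → s ≉ 0ℤ → χ (s * s * a) ≡ χ a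
  χ-square-*-≉0 {s} a s≉0 with χ a | legendre-view a
  ... | _ | divisible a≈0 = χ-≈0 (≈0-*ˡ (s * s) a≈0)
  ... | _ | residue a≉0 (r , r²≈a) =
    χ-residue (≉0-* (≉0-* s≉0 s≉0) a≉0) (s * r , ≈-trans (≈-reflexive (ring s r)) (*-cong (≈-refl {s * s}) r²≈a))
    where
    ring : ∀ s r → s * r * (s * r) ≡ s * s * (r * r)
    ring = solve-∀
  ... | _ | nonresidue nonsquare = χ-nonresidue λ (w , w²≈s²a) → nonsquare (w * s⁻¹ , (begin
    w * s⁻¹ * (w * s⁻¹)           ≈⟨ ≈-reflexive (ring w s⁻¹) ⟩
    w * w * (s⁻¹ * s⁻¹)           ≈⟨ *-cong w²≈s²a (≈-refl {s⁻¹ * s⁻¹}) ⟩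
    s * s * a * (s⁻¹ * s⁻¹)       ≈⟨ ≈-reflexive (ring′ s a s⁻¹) ⟩
    s * s⁻¹ * (s * s⁻¹) * a       ≈⟨ *-cong (*-cong ss⁻¹≈1 ss⁻¹≈1) (≈-refl {a}) ⟩
    1ℤ * 1ℤ * a                   ≈⟨ ≈-reflexive (*-identityˡ a) ⟩
    a                             ∎))
    where
    open ≈-Reasoning
    s⁻¹ = proj₁ (inverse s≉0)
    ss⁻¹≈1 = proj₂ (inverse s≉0)
    ring : ∀ w t → w * t * (w * t) ≡ w * w * (t * t)
    ring = solve-∀
    ring′ : ∀ s a t → s * s * a * (t * t) ≡ s * t * (s * t) * a
    ring′ = solve-∀

  -- As a is a nonresidue, every term of Σₓ (χ(a·x) + χ(x)) = 0 is ≤ 0, hence 0; at x = b this is χ(a·b) = −χ(b).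
  χ-*-nonresidues : ∀ {a b} → ¬ IsSquare a → ¬ IsSquare b → χ (a * b) ≡ 1ℤ
  χ-*-nonresidues {a} {b} a-nonsquare b-nonsquare = begin
    χ (a * b)                          ≡⟨ ring (χ (a * b)) (χ b) ⟩
    χ (a * b) + χ b - χ b              ≡⟨ cong₂ _-_ g[b]≡0 (χ-nonresidue b-nonsquare) ⟩
    0ℤ - -1ℤ                           ∎
    where
    open ≡-Reasoning
    ring : ∀ u v → u ≡ u + v - v
    ring = solve-∀
    g : ℤ → ℤ
    g x = χ (a * x) + χ x
    ∑g≡0 : ∑ᵣ g ≡ 0ℤ
    ∑g≡0 = trans (∑ᵣ-+ (λ x → χ (a * x)) χ)
      (cong₂ _+_ (trans (∑ᵣ-scale χ (λ a≈0 → a-nonsquare (0ℤ , ≈-sym a≈0)) χ-cong) ∑ᵣ-χ) ∑ᵣ-χ)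
    g≤0 : ∀ x → g x ≤ 0ℤ
    g≤0 x with χ x | legendre-view x
    ... | _ | divisible x≈0 = ≤-reflexive (cong (_+ 0ℤ) (χ-≈0 (≈0-*ˡ a x≈0)))
    ... | _ | residue x≉0 (r , r²≈x) = ≤-reflexive (cong (_+ 1ℤ) (begin
      χ (a * x)           ≡⟨ χ-cong (≈-trans (*-cong (≈-refl {a}) (≈-sym r²≈x)) (≈-reflexive (*-comm a (r * r)))) ⟩
      χ (r * r * a)       ≡⟨ χ-square-*-≉0 {r} a (λ r≈0 → x≉0 (≈-trans (≈-sym r²≈x) (≈0-*ʳ r r≈0))) ⟩
      χ a                 ≡⟨ χ-nonresidue a-nonsquare ⟩
      -1ℤ                 ∎))
    ... | _ | nonresidue _ = +-monoˡ-≤ -1ℤ (χ≤1 (a * x))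
    g[b]≡0 : g b ≡ 0ℤ
    g[b]≡0 = trans (cong₂ _+_ (χ-cong (*-cong (≈-refl {a}) b≈b′)) (χ-cong b≈b′))
                   (∑-nonpositive-zero (g ∘ res) (g≤0 ∘ res) ∑g≡0 (reduce b))
      where
      b≈b′ = ≈-sym (res-reduce b)

  χ-* : ∀ a b → χ (a * b) ≡ χ a * χ b
  χ-* a b with χ a | legendre-view a
  ... | _ | divisible a≈0 = χ-≈0 (≈0-*ʳ b a≈0)
  ... | _ | residue a≉0 (r , r²≈a) = begin
    χ (a * b)       ≡⟨ χ-cong (*-cong (≈-sym r²≈a) (≈-refl {b})) ⟩
    χ (r * r * b)   ≡⟨ χ-square-*-≉0 {r} b (λ r≈0 → a≉0 (≈-trans (≈-sym r²≈a) (≈0-*ʳ r r≈0))) ⟩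
    χ b             ≡⟨ sym (*-identityˡ (χ b)) ⟩
    1ℤ * χ b        ∎
    where open ≡-Reasoning
  ... | _ | nonresidue a-nonsquare with χ b | legendre-view b
  ...   | _ | divisible b≈0 = χ-≈0 (≈0-*ˡ a b≈0)
  ...   | _ | residue b≉0 (r , r²≈b) = begin
    χ (a * b)       ≡⟨ χ-cong (≈-trans (*-cong (≈-refl {a}) (≈-sym r²≈b)) (≈-reflexive (*-comm a (r * r)))) ⟩
    χ (r * r * a)   ≡⟨ χ-square-*-≉0 {r} a (λ r≈0 → b≉0 (≈-trans (≈-sym r²≈b) (≈0-*ʳ r r≈0))) ⟩
    χ a             ≡⟨ χ-nonresidue a-nonsquare ⟩
    -1ℤ             ∎
    where open ≡-Reasoning
  ...   | _ | nonresidue b-nonsquare = χ-*-nonresidues a-nonsquare b-nonsquare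

  χ-square-* : ∀ y a → χ (y * y * a) ≡ (1ℤ - [ y ≡0]) * χ a
  χ-square-* y a with y ≈?0
  ... | yes y≈0 = trans (χ-≈0 (≈0-*ʳ a (≈0-*ʳ y y≈0))) (sym (cong (λ t → (1ℤ - t) * χ a) ([≡0]-≈0 y≈0)))
  ... | no y≉0 = trans (χ-square-*-≉0 a y≉0) (sym (trans (cong (λ t → (1ℤ - t) * χ a) ([≡0]-≉0 y≉0)) (*-identityˡ (χ a))))

  ∑ᵣ-χ-square-sub-≈0 : ∀ {k} → k ≈ 0ℤ → ∑ᵣ[ u ] χ (u * u - k) ≡ + p - 1ℤ
  ∑ᵣ-χ-square-sub-≈0 {k} k≈0 = trans (∑ᵣ-cong unit-indicator) ∑ᵣ-units
    where
    u²-k≈u²·1 : ∀ u → u * u - k ≈ u * u * 1ℤ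
    u²-k≈u²·1 u = ≈-trans (sub-cong (≈-refl {u * u}) k≈0) (≈-reflexive (ring u))
      where
      ring : ∀ u → u * u - 0ℤ ≡ u * u * 1ℤ
      ring = solve-∀
    unit-indicator : ∀ u → χ (u * u - k) ≡ 1ℤ - [ u ≡0]
    unit-indicator u = begin
      χ (u * u - k)                ≡⟨ χ-cong (u²-k≈u²·1 u) ⟩
      χ (u * u * 1ℤ)               ≡⟨ χ-square-* u 1ℤ ⟩
      (1ℤ - [ u ≡0]) * χ 1ℤ        ≡⟨ cong ((1ℤ - [ u ≡0]) *_) (χ-residue 1≉0 (1ℤ , ≈-refl)) ⟩
      (1ℤ - [ u ≡0]) * 1ℤ          ≡⟨ *-identityʳ (1ℤ - [ u ≡0]) ⟩
      1ℤ - [ u ≡0]                 ∎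
      where open ≡-Reasoning

  -- χ(u² − k) + 1 counts the v with v² ≡ u² − k; substituting v = w + u leaves 2wu + w² + k,
  -- which for fixed w ≢ 0 has exactly one root u and for w ≡ 0 none.
  ∑ᵣ-χ-square-sub-≉0 : ∀ {k} → k ≉ 0ℤ → ∑ᵣ[ u ] χ (u * u - k) ≡ -1ℤ
  ∑ᵣ-χ-square-sub-≉0 {k} k≉0 = begin
    ∑ᵣ[ u ] χ (u * u - k)                                     ≡⟨ ∑ᵣ-cong (λ u → χ-as-count (u * u - k)) ⟩
    ∑ᵣ[ u ] (∑ᵣ[ v ] [ v * v - (u * u - k) ≡0] - 1ℤ)          ≡⟨ ∑ᵣ-- (λ u → ∑ᵣ[ v ] [ v * v - (u * u - k) ≡0]) (λ _ → 1ℤ) ⟩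
    ∑ᵣ[ u ] ∑ᵣ[ v ] [ v * v - (u * u - k) ≡0] - ∑ᵣ[ _ ] 1ℤ    ≡⟨ cong₂ _-_ (∑ᵣ-cong shift) (∑ᵣ-const 1ℤ) ⟩
    ∑ᵣ[ u ] ∑ᵣ[ w ] [ + 2 * w * u + (w * w + k) ≡0] - + p * 1ℤ ≡⟨ cong (_- + p * 1ℤ) (∑ᵣ-comm (λ u w → [ + 2 * w * u + (w * w + k) ≡0])) ⟩
    ∑ᵣ[ w ] ∑ᵣ[ u ] [ + 2 * w * u + (w * w + k) ≡0] - + p * 1ℤ ≡⟨ cong (_- + p * 1ℤ) (trans (∑ᵣ-cong roots-in-u) ∑ᵣ-units) ⟩
    + p - 1ℤ - + p * 1ℤ                                       ≡⟨ ring (+ p) ⟩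
    -1ℤ                                                       ∎
    where
    open ≡-Reasoning
    ring : ∀ p → p - 1ℤ - p * 1ℤ ≡ -1ℤ
    ring = solve-∀
    shift : ∀ u → ∑ᵣ[ v ] [ v * v - (u * u - k) ≡0] ≡ ∑ᵣ[ w ] [ + 2 * w * u + (w * w + k) ≡0]
    shift u = trans (sym (∑ᵣ-affine u h 1≉0 (λ v≈v′ → [≡0]-cong (sub-cong (*-cong v≈v′ v≈v′) (≈-refl {u * u - k})))))
                    (∑ᵣ-cong λ w → cong [_≡0] (ring′ w u k))
      where
      h = λ v → [ v * v - (u * u - k) ≡0]
      ring′ : ∀ w u k → (1ℤ * w + u) * (1ℤ * w + u) - (u * u - k) ≡ + 2 * w * u + (w * w + k)
      ring′ = solve-∀
    roots-in-u : ∀ w → ∑ᵣ[ u ] [ + 2 * w * u + (w * w + k) ≡0] ≡ 1ℤ - [ w ≡0]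
    roots-in-u w with w ≈?0
    ... | yes w≈0 = trans (∑ᵣ-zero λ u → [≡0]-≉0 λ e≈0 → k≉0 (≈-trans (≈-sym (≈k u)) e≈0))
                          (sym (cong (_-_ 1ℤ) ([≡0]-≈0 w≈0)))
      where
      ≈k : ∀ u → + 2 * w * u + (w * w + k) ≈ k
      ≈k u = ≈-trans (≈-reflexive (ring″ w u k)) (≈-trans (+-cong (≈0-*ˡ (+ 2 * u + w) w≈0) (≈-refl {k})) (≈-reflexive (+-identityˡ k)))
        where
        ring″ : ∀ w u k → + 2 * w * u + (w * w + k) ≡ (+ 2 * u + w) * w + k
        ring″ = solve-∀
    ... | no w≉0 = trans (linear-root-count (w * w + k) (≉0-* 2≉0 w≉0)) (sym (cong (_-_ 1ℤ) ([≡0]-≉0 w≉0)))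

  binary-form-zero-count : ∀ a b {c} → c ≉ 0ℤ →
    ∑ᵣ[ y ] ∑ᵣ[ z ] [ a * y * y + b * y * z + c * z * z ≡0] ≡ + p + (+ p - 1ℤ) * χ (b * b - + 4 * a * c)
  binary-form-zero-count a b {c} c≉0 = begin
    ∑ᵣ[ y ] ∑ᵣ[ z ] [ a * y * y + b * y * z + c * z * z ≡0]    ≡⟨ ∑ᵣ-cong roots-in-z ⟩
    ∑ᵣ[ y ] (1ℤ + (1ℤ - [ y ≡0]) * χ Δ)                         ≡⟨ ∑ᵣ-+ (λ _ → 1ℤ) (λ y → (1ℤ - [ y ≡0]) * χ Δ) ⟩
    ∑ᵣ[ _ ] 1ℤ + ∑ᵣ[ y ] ((1ℤ - [ y ≡0]) * χ Δ)                 ≡⟨ cong₂ _+_ (trans (∑ᵣ-const 1ℤ) (*-identityʳ (+ p)))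
                                                                         (trans (∑ᵣ-*ʳ (χ Δ) (λ y → 1ℤ - [ y ≡0])) (cong (_* χ Δ) ∑ᵣ-units)) ⟩
    + p + (+ p - 1ℤ) * χ Δ                                      ∎
    where
    open ≡-Reasoning
    Δ = b * b - + 4 * a * c
    roots-in-z : ∀ y → ∑ᵣ[ z ] [ a * y * y + b * y * z + c * z * z ≡0] ≡ 1ℤ + (1ℤ - [ y ≡0]) * χ Δ
    roots-in-z y = trans (∑ᵣ-cong (λ z → cong [_≡0] (ring a b c y z)))
                  (trans (quadratic-root-count (b * y) (a * y * y) c≉0)
                         (cong (_+_ 1ℤ) (trans (cong χ (ring′ a b c y)) (χ-square-* y Δ))))
      where
      ring : ∀ a b c y z → a * y * y + b * y * z + c * z * z ≡ c * z * z + b * y * z + a * y * y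
      ring = solve-∀
      ring′ : ∀ a b c y → b * y * (b * y) - + 4 * c * (a * y * y) ≡ y * y * (b * b - + 4 * a * c)
      ring′ = solve-∀

  χ-±1 : ∀ {a} → a ≉ 0ℤ → χ a ≡ 1ℤ ⊎ χ a ≡ -1ℤ
  χ-±1 {a} a≉0 with χ a | legendre-view a
  ... | _ | divisible a≈0 = ⊥-elim (a≉0 a≈0)
  ... | _ | residue _ _ = inj₁ refl
  ... | _ | nonresidue _ = inj₂ refl

  ±1-inverse-unique : ∀ {x y} → x ≡ 1ℤ ⊎ x ≡ -1ℤ → x * y ≡ 1ℤ → x ≡ y
  ±1-inverse-unique {y = y} (inj₁ refl) xy≡1 = trans (sym xy≡1) (*-identityˡ y)
  ±1-inverse-unique {y = y} (inj₂ refl) xy≡1 = begin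
    -1ℤ         ≡⟨ cong -_ (sym xy≡1) ⟩
    - (-1ℤ * y) ≡⟨ cong -_ (-1*i≡-i y) ⟩
    - - y       ≡⟨ neg-involutive y ⟩
    y           ∎
    where open ≡-Reasoning

  χ-neg-product-square : ∀ {a b} c → a * b ≈ c * c → a ≉ 0ℤ → b ≉ 0ℤ → χ (- a) ≡ χ (- b)
  χ-neg-product-square {a} {b} c ab≈c² a≉0 b≉0 = ±1-inverse-unique (χ-±1 (≉0-neg a≉0)) (begin
    χ (- a) * χ (- b)   ≡⟨ sym (χ-* (- a) (- b)) ⟩
    χ (- a * - b)       ≡⟨ χ-cong (≈-trans (≈-reflexive (ring a b)) ab≈c²) ⟩
    χ (c * c)           ≡⟨ χ-square {c} (λ c≈0 → ≉0-* a≉0 b≉0 (≈-trans ab≈c² (≈0-*ʳ c c≈0))) ⟩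
    1ℤ                  ∎)
    where
    open ≡-Reasoning
    ring : ∀ a b → - a * - b ≡ a * b
    ring = solve-∀

  -- Binary quadratic forms

  module BinaryForm (α β γ : ℤ) where

    discriminant : ℤ
    discriminant = β * β - + 4 * α * γ

    form : ℤ → ℤ → ℤ
    form x y = α * x * x + β * x * y + γ * y * y

    character-sum : ℤ
    character-sum = ∑ᵣ[ x ] ∑ᵣ[ y ] χ (form x y)

    dehomogenised-sum : ℤ
    dehomogenised-sum = ∑ᵣ[ s ] χ (γ * s * s + β * s + α)

    row-sum-≈0 : ∀ {x} → x ≈ 0ℤ → ∑ᵣ[ y ] χ (form x y) ≡ (+ p - 1ℤ) * χ γ
    row-sum-≈0 {x} x≈0 = trans (∑ᵣ-cong row) (trans (∑ᵣ-*ʳ (χ γ) (λ y → 1ℤ - [ y ≡0])) (cong (_* χ γ) ∑ᵣ-units))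
      where
      row : ∀ y → χ (form x y) ≡ (1ℤ - [ y ≡0]) * χ γ
      row y = trans (χ-cong (≈-trans (≈-reflexive (ring α β γ x y))
                                     (≈-trans (+-cong (≈0-*ˡ (α * x + β * y) x≈0) (≈-refl {y * y * γ})) (≈-reflexive (+-identityˡ _)))))
                    (χ-square-* y γ)
        where
        ring : ∀ α β γ x y → α * x * x + β * x * y + γ * y * y ≡ (α * x + β * y) * x + y * y * γ
        ring = solve-∀

    row-sum-≉0 : ∀ {x} → x ≉ 0ℤ → ∑ᵣ[ y ] χ (form x y) ≡ dehomogenised-sum
    row-sum-≉0 {x} x≉0 = begin
      ∑ᵣ[ y ] χ (form x y)                             ≡⟨ sym (∑ᵣ-scale (λ y → χ (form x y)) x≉0 form-cong) ⟩
      ∑ᵣ[ s ] χ (form x (x * s))                       ≡⟨ ∑ᵣ-cong (λ s → cong χ (ring α β γ x s)) ⟩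
      ∑ᵣ[ s ] χ (x * x * (γ * s * s + β * s + α))      ≡⟨ ∑ᵣ-cong (λ s → χ-square-*-≉0 (γ * s * s + β * s + α) x≉0) ⟩
      dehomogenised-sum                                ∎
      where
      open ≡-Reasoning
      form-cong : (λ y → χ (form x y)) Preserves _≈_ ⟶ _≡_
      form-cong y≈y′ = χ-cong (+-cong (+-cong (≈-refl {α * x * x}) (*-cong (≈-refl {β * x}) y≈y′))
                                      (*-cong (*-cong (≈-refl {γ}) y≈y′) y≈y′))
      ring : ∀ α β γ x s → α * x * x + β * x * (x * s) + γ * (x * s) * (x * s) ≡ x * x * (γ * s * s + β * s + α)
      ring = solve-∀

    character-sum-split : character-sum ≡ (+ p - 1ℤ) * χ γ + (+ p - 1ℤ) * dehomogenised-sum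
    character-sum-split = ∑ᵣ-by-zero (λ x → ∑ᵣ[ y ] χ (form x y)) _ _ row-sum-≈0 row-sum-≉0

    dehomogenised-sum-γ≉0 : γ ≉ 0ℤ → dehomogenised-sum ≡ χ γ * ∑ᵣ[ u ] χ (u * u - discriminant)
    dehomogenised-sum-γ≉0 γ≉0 = begin
      dehomogenised-sum                                         ≡⟨ ∑ᵣ-cong complete-square ⟩
      ∑ᵣ[ s ] (χ γ * χ (shifted (+ 2 * γ * s + β)))             ≡⟨ ∑ᵣ-*ˡ (χ γ) (λ s → χ (shifted (+ 2 * γ * s + β))) ⟩
      χ γ * ∑ᵣ[ s ] χ (shifted (+ 2 * γ * s + β))               ≡⟨ cong (χ γ *_) (∑ᵣ-affine β (χ ∘ shifted) (≉0-* 2≉0 γ≉0) shifted-cong) ⟩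
      χ γ * ∑ᵣ[ u ] χ (u * u - discriminant)                    ∎
      where
      open ≡-Reasoning
      shifted : ℤ → ℤ
      shifted u = u * u - discriminant
      shifted-cong : (χ ∘ shifted) Preserves _≈_ ⟶ _≡_
      shifted-cong u≈v = χ-cong (sub-cong (*-cong u≈v u≈v) (≈-refl {discriminant}))
      χγ²≡1 : χ γ * χ γ ≡ 1ℤ
      χγ²≡1 = trans (sym (χ-* γ γ)) (χ-square γ≉0)
      complete-square : ∀ s → χ (γ * s * s + β * s + α) ≡ χ γ * χ (shifted (+ 2 * γ * s + β))
      complete-square s = begin
        χ e                                  ≡⟨ sym (*-identityˡ (χ e)) ⟩
        1ℤ * χ e                             ≡⟨ cong (_* χ e) (sym χγ²≡1) ⟩
        χ γ * χ γ * χ e                      ≡⟨ *-assoc (χ γ) (χ γ) (χ e) ⟩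
        χ γ * (χ γ * χ e)                    ≡⟨ cong (χ γ *_) (sym (χ-* γ e)) ⟩
        χ γ * χ (γ * e)                      ≡⟨ cong (χ γ *_) (sym (χ-square-*-≉0 (γ * e) 2≉0)) ⟩
        χ γ * χ (+ 2 * + 2 * (γ * e))        ≡⟨ cong (λ t → χ γ * χ t) (ring α β γ s) ⟩
        χ γ * χ (shifted (+ 2 * γ * s + β))  ∎
        where
        e = γ * s * s + β * s + α
        ring : ∀ α β γ s → + 2 * + 2 * (γ * (γ * s * s + β * s + α)) ≡ (+ 2 * γ * s + β) * (+ 2 * γ * s + β) - (β * β - + 4 * α * γ)
        ring = solve-∀

    dehomogenised-sum-linear : γ ≈ 0ℤ → β ≉ 0ℤ → dehomogenised-sum ≡ 0ℤ
    dehomogenised-sum-linear γ≈0 β≉0 = trans (∑ᵣ-cong (λ s → χ-cong (drop-square s))) (trans (∑ᵣ-affine α χ β≉0 χ-cong) ∑ᵣ-χ)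
      where
      drop-square : ∀ s → γ * s * s + β * s + α ≈ β * s + α
      drop-square s = ≈-trans (≈-reflexive (ring γ s β α)) (≈-trans (+-cong (≈0-*ʳ (s * s) γ≈0) (≈-refl {β * s + α})) (≈-reflexive (+-identityˡ _)))
        where
        ring : ∀ γ s β α → γ * s * s + β * s + α ≡ γ * (s * s) + (β * s + α)
        ring = solve-∀

    dehomogenised-sum-constant : γ ≈ 0ℤ → β ≈ 0ℤ → dehomogenised-sum ≡ + p * χ α
    dehomogenised-sum-constant γ≈0 β≈0 = trans (∑ᵣ-cong (λ s → χ-cong (drop-linear s))) (∑ᵣ-const (χ α))
      where
      drop-linear : ∀ s → γ * s * s + β * s + α ≈ α
      drop-linear s = ≈-trans (+-cong (+-cong (≈0-*ʳ s (≈0-*ʳ s γ≈0)) (≈0-*ʳ s β≈0)) (≈-refl {α})) (≈-reflexive (+-identityˡ α))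

    character-sum-nondegenerate : discriminant ≉ 0ℤ → character-sum ≡ 0ℤ
    character-sum-nondegenerate δ≉0 with γ ≈?0
    ... | no γ≉0 = begin
      character-sum                                                           ≡⟨ character-sum-split ⟩
      (+ p - 1ℤ) * χ γ + (+ p - 1ℤ) * dehomogenised-sum                       ≡⟨ cong (λ U → (+ p - 1ℤ) * χ γ + (+ p - 1ℤ) * U)
                                                                                   (trans (dehomogenised-sum-γ≉0 γ≉0) (cong (χ γ *_) (∑ᵣ-χ-square-sub-≉0 δ≉0))) ⟩
      (+ p - 1ℤ) * χ γ + (+ p - 1ℤ) * (χ γ * -1ℤ)                             ≡⟨ ring (+ p) (χ γ) ⟩
      0ℤ                                                                      ∎
      where
      open ≡-Reasoning
      ring : ∀ p c → (p - 1ℤ) * c + (p - 1ℤ) * (c * -1ℤ) ≡ 0ℤ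
      ring = solve-∀
    ... | yes γ≈0 = begin
      character-sum                                                           ≡⟨ character-sum-split ⟩
      (+ p - 1ℤ) * χ γ + (+ p - 1ℤ) * dehomogenised-sum                       ≡⟨ cong₂ (λ c U → (+ p - 1ℤ) * c + (+ p - 1ℤ) * U)
                                                                                   (χ-≈0 γ≈0) (dehomogenised-sum-linear γ≈0 β≉0) ⟩
      (+ p - 1ℤ) * 0ℤ + (+ p - 1ℤ) * 0ℤ                                       ≡⟨ ring (+ p) ⟩
      0ℤ                                                                      ∎
      where
      open ≡-Reasoning
      ring : ∀ p → (p - 1ℤ) * 0ℤ + (p - 1ℤ) * 0ℤ ≡ 0ℤ
      ring = solve-∀
      β≉0 : β ≉ 0ℤ
      β≉0 β≈0 = δ≉0 (sub-cong (≈0-*ʳ β β≈0) (≈0-*ˡ (+ 4 * α) γ≈0))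

    character-sum-degenerate : discriminant ≈ 0ℤ → γ ≉ 0ℤ → character-sum ≡ (+ p - 1ℤ) * (+ p * χ γ)
    character-sum-degenerate δ≈0 γ≉0 = begin
      character-sum                                                           ≡⟨ character-sum-split ⟩
      (+ p - 1ℤ) * χ γ + (+ p - 1ℤ) * dehomogenised-sum                       ≡⟨ cong (λ U → (+ p - 1ℤ) * χ γ + (+ p - 1ℤ) * U)
                                                                                   (trans (dehomogenised-sum-γ≉0 γ≉0) (cong (χ γ *_) (∑ᵣ-χ-square-sub-≈0 δ≈0))) ⟩
      (+ p - 1ℤ) * χ γ + (+ p - 1ℤ) * (χ γ * (+ p - 1ℤ))                      ≡⟨ ring (+ p) (χ γ) ⟩
      (+ p - 1ℤ) * (+ p * χ γ)                                                ∎
      where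
      open ≡-Reasoning
      ring : ∀ p c → (p - 1ℤ) * c + (p - 1ℤ) * (c * (p - 1ℤ)) ≡ (p - 1ℤ) * (p * c)
      ring = solve-∀

    character-sum-degenerate-γ≈0 : discriminant ≈ 0ℤ → γ ≈ 0ℤ → character-sum ≡ (+ p - 1ℤ) * (+ p * χ α)
    character-sum-degenerate-γ≈0 δ≈0 γ≈0 = begin
      character-sum                                                           ≡⟨ character-sum-split ⟩
      (+ p - 1ℤ) * χ γ + (+ p - 1ℤ) * dehomogenised-sum                       ≡⟨ cong₂ (λ c U → (+ p - 1ℤ) * c + (+ p - 1ℤ) * U)
                                                                                   (χ-≈0 γ≈0) (dehomogenised-sum-constant γ≈0 β≈0) ⟩
      (+ p - 1ℤ) * 0ℤ + (+ p - 1ℤ) * (+ p * χ α)                              ≡⟨ ring (+ p) (χ α) ⟩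
      (+ p - 1ℤ) * (+ p * χ α)                                                ∎
      where
      open ≡-Reasoning
      ring : ∀ p c → (p - 1ℤ) * 0ℤ + (p - 1ℤ) * (p * c) ≡ (p - 1ℤ) * (p * c)
      ring = solve-∀
      β²≈0 : β * β ≈ 0ℤ
      β²≈0 = ≈-trans (≈-reflexive (ring′ α β γ)) (+-cong δ≈0 (≈0-*ˡ (+ 4 * α) γ≈0))
        where
        ring′ : ∀ α β γ → β * β ≡ β * β - + 4 * α * γ + + 4 * α * γ
        ring′ = solve-∀
      β≈0 : β ≈ 0ℤ
      β≈0 = square-≈0⇒≈0 β²≈0

  ∑³ : (ℤ → ℤ → ℤ → ℤ) → ℤ
  ∑³ f = ∑ᵣ[ x ] ∑ᵣ[ y ] ∑ᵣ[ z ] f x y z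

  Respects³ : (ℤ → ℤ → ℤ → ℤ) → Set
  Respects³ f = ∀ {x x′ y y′ z z′} → x ≈ x′ → y ≈ y′ → z ≈ z′ → f x y z ≡ f x′ y′ z′

  ∑³-cong : ∀ {f g : ℤ → ℤ → ℤ → ℤ} → (∀ x y z → f x y z ≡ g x y z) → ∑³ f ≡ ∑³ g
  ∑³-cong f≗g = ∑ᵣ-cong λ x → ∑ᵣ-cong λ y → ∑ᵣ-cong λ z → f≗g x y z

  ∑³-+ : ∀ (f g : ℤ → ℤ → ℤ → ℤ) → ∑³ (λ x y z → f x y z + g x y z) ≡ ∑³ f + ∑³ g
  ∑³-+ f g = trans (∑ᵣ-cong λ x → trans (∑ᵣ-cong λ y → ∑ᵣ-+ (f x y) (g x y))
                                       (∑ᵣ-+ (λ y → ∑ᵣ (f x y)) (λ y → ∑ᵣ (g x y))))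
                   (∑ᵣ-+ (λ x → ∑ᵣ[ y ] ∑ᵣ (f x y)) (λ x → ∑ᵣ[ y ] ∑ᵣ (g x y)))

  ∑³-- : ∀ (f g : ℤ → ℤ → ℤ → ℤ) → ∑³ (λ x y z → f x y z - g x y z) ≡ ∑³ f - ∑³ g
  ∑³-- f g = trans (∑ᵣ-cong λ x → trans (∑ᵣ-cong λ y → ∑ᵣ-- (f x y) (g x y))
                                       (∑ᵣ-- (λ y → ∑ᵣ (f x y)) (λ y → ∑ᵣ (g x y))))
                   (∑ᵣ-- (λ x → ∑ᵣ[ y ] ∑ᵣ (f x y)) (λ x → ∑ᵣ[ y ] ∑ᵣ (g x y)))

  ∑³-*ˡ : ∀ c (f : ℤ → ℤ → ℤ → ℤ) → ∑³ (λ x y z → c * f x y z) ≡ c * ∑³ f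
  ∑³-*ˡ c f = trans (∑ᵣ-cong λ x → trans (∑ᵣ-cong λ y → ∑ᵣ-*ˡ c (f x y)) (∑ᵣ-*ˡ c (λ y → ∑ᵣ (f x y))))
                    (∑ᵣ-*ˡ c (λ x → ∑ᵣ[ y ] ∑ᵣ (f x y)))

  ∑³-product : ∀ (f g h : ℤ → ℤ) → ∑³ (λ x y z → f x * g y * h z) ≡ ∑ᵣ f * ∑ᵣ g * ∑ᵣ h
  ∑³-product f g h = trans (∑ᵣ-cong λ x → trans (∑ᵣ-cong λ y → ∑ᵣ-*ˡ (f x * g y) h)
                                                (trans (∑ᵣ-*ʳ (∑ᵣ h) (λ y → f x * g y)) (cong (_* ∑ᵣ h) (∑ᵣ-*ˡ (f x) g))))
                           (trans (∑ᵣ-*ʳ (∑ᵣ h) (λ x → f x * ∑ᵣ g)) (cong (_* ∑ᵣ h) (∑ᵣ-*ʳ (∑ᵣ g) f)))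

  ∑³-comm-∑ᵣ : ∀ (f : ℤ → ℤ → ℤ → ℤ → ℤ) → ∑ᵣ[ t ] ∑³ (f t) ≡ ∑³ (λ x y z → ∑ᵣ[ t ] f t x y z)
  ∑³-comm-∑ᵣ f = trans (∑ᵣ-comm (λ t x → ∑ᵣ[ y ] ∑ᵣ[ z ] f t x y z))
                 (∑ᵣ-cong λ x → trans (∑ᵣ-comm (λ t y → ∑ᵣ[ z ] f t x y z))
                                (∑ᵣ-cong λ y → ∑ᵣ-comm (λ t z → f t x y z)))

  ∑³-scale : ∀ {t} (f : ℤ → ℤ → ℤ → ℤ) → t ≉ 0ℤ → Respects³ f → ∑³ (λ x y z → f (t * x) (t * y) (t * z)) ≡ ∑³ f
  ∑³-scale {t} f t≉0 f-cong = begin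
    ∑³ (λ x y z → f (t * x) (t * y) (t * z))     ≡⟨ ∑ᵣ-cong (λ x → ∑ᵣ-cong λ y → ∑ᵣ-scale (f (t * x) (t * y)) t≉0 (f-cong (≈-refl {t * x}) (≈-refl {t * y}))) ⟩
    ∑³ (λ x y z → f (t * x) (t * y) z)           ≡⟨ ∑ᵣ-cong (λ x → ∑ᵣ-scale (λ y → ∑ᵣ (f (t * x) y)) t≉0
                                                                       (λ y≈y′ → ∑ᵣ-cong λ z → f-cong (≈-refl {t * x}) y≈y′ (≈-refl {z}))) ⟩
    ∑³ (λ x y z → f (t * x) y z)                 ≡⟨ ∑ᵣ-scale (λ x → ∑ᵣ[ y ] ∑ᵣ (f x y)) t≉0
                                                              (λ x≈x′ → ∑ᵣ-cong λ y → ∑ᵣ-cong λ z → f-cong x≈x′ (≈-refl {y}) (≈-refl {z})) ⟩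
    ∑³ f                                         ∎
    where open ≡-Reasoning

  ∑²-at-first : ∀ (h : ℤ → ℤ → ℤ) → (∀ {y y′} z → y ≈ y′ → h y z ≡ h y′ z) →
    ∑ᵣ[ y ] ∑ᵣ[ z ] ([ y ≡0] * h y z) ≡ ∑ᵣ (h 0ℤ)
  ∑²-at-first h h-cong = trans (∑ᵣ-cong λ y → ∑ᵣ-*ˡ [ y ≡0] (h y))
                               (∑ᵣ-[≡0]-* (∑ᵣ ∘ h) (λ y≈y′ → ∑ᵣ-cong λ z → h-cong z y≈y′))

  ∑²-at-second : ∀ (h : ℤ → ℤ → ℤ) → (∀ y {z z′} → z ≈ z′ → h y z ≡ h y z′) →
    ∑ᵣ[ y ] ∑ᵣ[ z ] ([ z ≡0] * h y z) ≡ ∑ᵣ[ y ] h y 0ℤ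
  ∑²-at-second h h-cong = ∑ᵣ-cong λ y → ∑ᵣ-[≡0]-* (h y) (h-cong y)

  ∑³-at-x≡0 : ∀ f → Respects³ f → ∑³ (λ x y z → [ x ≡0] * f x y z) ≡ ∑ᵣ[ y ] ∑ᵣ[ z ] f 0ℤ y z
  ∑³-at-x≡0 f f-cong = trans (∑ᵣ-cong λ x → trans (∑ᵣ-cong λ y → ∑ᵣ-*ˡ [ x ≡0] (f x y)) (∑ᵣ-*ˡ [ x ≡0] (λ y → ∑ᵣ (f x y))))
                             (∑ᵣ-[≡0]-* (λ x → ∑ᵣ[ y ] ∑ᵣ (f x y)) (λ x≈x′ → ∑ᵣ-cong λ y → ∑ᵣ-cong λ z → f-cong x≈x′ (≈-refl {y}) (≈-refl {z})))

  ∑³-at-y≡0 : ∀ f → Respects³ f → ∑³ (λ x y z → [ y ≡0] * f x y z) ≡ ∑ᵣ[ x ] ∑ᵣ[ z ] f x 0ℤ z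
  ∑³-at-y≡0 f f-cong = ∑ᵣ-cong λ x → ∑²-at-first (f x) (λ z y≈y′ → f-cong (≈-refl {x}) y≈y′ (≈-refl {z}))

  ∑³-at-z≡0 : ∀ f → Respects³ f → ∑³ (λ x y z → [ z ≡0] * f x y z) ≡ ∑ᵣ[ x ] ∑ᵣ[ y ] f x y 0ℤ
  ∑³-at-z≡0 f f-cong = ∑ᵣ-cong λ x → ∑²-at-second (f x) (λ y z≈z′ → f-cong (≈-refl {x}) (≈-refl {y}) z≈z′)

  ∑³-inclusion-exclusion : ∀ q → Respects³ q →
    ∑³ (λ x y z → [ x * y * z ≡0] * q x y z) ≡
      ∑ᵣ[ y ] ∑ᵣ[ z ] q 0ℤ y z + ∑ᵣ[ x ] ∑ᵣ[ z ] q x 0ℤ z + ∑ᵣ[ x ] ∑ᵣ[ y ] q x y 0ℤ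
      - ∑ᵣ[ z ] q 0ℤ 0ℤ z - ∑ᵣ[ y ] q 0ℤ y 0ℤ - ∑ᵣ[ x ] q x 0ℤ 0ℤ + q 0ℤ 0ℤ 0ℤ
  ∑³-inclusion-exclusion q q-cong = begin
    ∑³ (λ x y z → [ x * y * z ≡0] * q x y z)
      ≡⟨ ∑³-cong expand ⟩
    ∑³ (λ x y z → qx x y z + qy x y z + qz x y z - qxy x y z - qxz x y z - qyz x y z + qxyz x y z)
      ≡⟨ ∑³-+ (λ x y z → qx x y z + qy x y z + qz x y z - qxy x y z - qxz x y z - qyz x y z) qxyz ⟩
    ∑³ (λ x y z → qx x y z + qy x y z + qz x y z - qxy x y z - qxz x y z - qyz x y z) + ∑³ qxyz
      ≡⟨ cong (_+ ∑³ qxyz) (∑³-- (λ x y z → qx x y z + qy x y z + qz x y z - qxy x y z - qxz x y z) qyz) ⟩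
    ∑³ (λ x y z → qx x y z + qy x y z + qz x y z - qxy x y z - qxz x y z) - ∑³ qyz + ∑³ qxyz
      ≡⟨ cong (λ s → s - ∑³ qyz + ∑³ qxyz) (∑³-- (λ x y z → qx x y z + qy x y z + qz x y z - qxy x y z) qxz) ⟩
    ∑³ (λ x y z → qx x y z + qy x y z + qz x y z - qxy x y z) - ∑³ qxz - ∑³ qyz + ∑³ qxyz
      ≡⟨ cong (λ s → s - ∑³ qxz - ∑³ qyz + ∑³ qxyz) (∑³-- (λ x y z → qx x y z + qy x y z + qz x y z) qxy) ⟩
    ∑³ (λ x y z → qx x y z + qy x y z + qz x y z) - ∑³ qxy - ∑³ qxz - ∑³ qyz + ∑³ qxyz
      ≡⟨ cong (λ s → s - ∑³ qxy - ∑³ qxz - ∑³ qyz + ∑³ qxyz)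
              (trans (∑³-+ (λ x y z → qx x y z + qy x y z) qz) (cong (_+ ∑³ qz) (∑³-+ qx qy))) ⟩
    ∑³ qx + ∑³ qy + ∑³ qz - ∑³ qxy - ∑³ qxz - ∑³ qyz + ∑³ qxyz
      ≡⟨ cong₂ (λ s t → s - ∑³ qxy - ∑³ qxz - ∑³ qyz + t)
               (cong₂ _+_ (cong₂ _+_ (∑³-at-x≡0 q q-cong) (∑³-at-y≡0 q q-cong)) (∑³-at-z≡0 q q-cong)) qxyz-sum ⟩
    planes - ∑³ qxy - ∑³ qxz - ∑³ qyz + q 0ℤ 0ℤ 0ℤ
      ≡⟨ cong₂ (λ s t → planes - s - t - ∑³ qyz + q 0ℤ 0ℤ 0ℤ) qxy-sum qxz-sum ⟩
    planes - ∑ᵣ[ z ] q 0ℤ 0ℤ z - ∑ᵣ[ y ] q 0ℤ y 0ℤ - ∑³ qyz + q 0ℤ 0ℤ 0ℤ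
    ≡⟨ cong (λ s → planes - ∑ᵣ[ z ] q 0ℤ 0ℤ z - ∑ᵣ[ y ] q 0ℤ y 0ℤ - s + q 0ℤ 0ℤ 0ℤ) qyz-sum ⟩
    planes - ∑ᵣ[ z ] q 0ℤ 0ℤ z - ∑ᵣ[ y ] q 0ℤ y 0ℤ - ∑ᵣ[ x ] q x 0ℤ 0ℤ + q 0ℤ 0ℤ 0ℤ ∎
    where
    open ≡-Reasoning
    planes = ∑ᵣ[ y ] ∑ᵣ[ z ] q 0ℤ y z + ∑ᵣ[ x ] ∑ᵣ[ z ] q x 0ℤ z + ∑ᵣ[ x ] ∑ᵣ[ y ] q x y 0ℤ
    qx qy qz qxy qxz qyz qxyz : ℤ → ℤ → ℤ → ℤ
    qx x y z = [ x ≡0] * q x y z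
    qy x y z = [ y ≡0] * q x y z
    qz x y z = [ z ≡0] * q x y z
    qxy x y z = [ x ≡0] * qy x y z
    qxz x y z = [ x ≡0] * qz x y z
    qyz x y z = [ y ≡0] * qz x y z
    qxyz x y z = [ x ≡0] * qyz x y z
    qy-cong : Respects³ qy
    qy-cong x≈ y≈ z≈ = cong₂ _*_ ([≡0]-cong y≈) (q-cong x≈ y≈ z≈)
    qz-cong : Respects³ qz
    qz-cong x≈ y≈ z≈ = cong₂ _*_ ([≡0]-cong z≈) (q-cong x≈ y≈ z≈)
    qyz-cong : Respects³ qyz
    qyz-cong x≈ y≈ z≈ = cong₂ _*_ ([≡0]-cong y≈) (qz-cong x≈ y≈ z≈)
    expand : ∀ x y z → [ x * y * z ≡0] * q x y z ≡
      qx x y z + qy x y z + qz x y z - qxy x y z - qxz x y z - qyz x y z + qxyz x y z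
    expand x y z = trans (cong (_* q x y z) (trans ([≡0]-* (x * y) z) (cong (λ u → u + [ z ≡0] - u * [ z ≡0]) ([≡0]-* x y))))
                         (ring [ x ≡0] [ y ≡0] [ z ≡0] (q x y z))
      where
      ring : ∀ X Y Z q → (X + Y - X * Y + Z - (X + Y - X * Y) * Z) * q ≡
        X * q + Y * q + Z * q - X * (Y * q) - X * (Z * q) - Y * (Z * q) + X * (Y * (Z * q))
      ring = solve-∀
    qxy-sum : ∑³ qxy ≡ ∑ᵣ[ z ] q 0ℤ 0ℤ z
    qxy-sum = trans (∑³-at-x≡0 qy qy-cong) (∑²-at-first (q 0ℤ) (λ z y≈ → q-cong (≈-refl {0ℤ}) y≈ (≈-refl {z})))
    qxz-sum : ∑³ qxz ≡ ∑ᵣ[ y ] q 0ℤ y 0ℤ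
    qxz-sum = trans (∑³-at-x≡0 qz qz-cong) (∑²-at-second (q 0ℤ) (λ y z≈ → q-cong (≈-refl {0ℤ}) (≈-refl {y}) z≈))
    qyz-sum : ∑³ qyz ≡ ∑ᵣ[ x ] q x 0ℤ 0ℤ
    qyz-sum = trans (∑³-at-y≡0 qz qz-cong) (∑²-at-second (λ x z → q x 0ℤ z) (λ x z≈ → q-cong (≈-refl {x}) (≈-refl {0ℤ}) z≈))
    qxyz-sum : ∑³ qxyz ≡ q 0ℤ 0ℤ 0ℤ
    qxyz-sum = trans (∑³-at-x≡0 qyz qyz-cong)
              (trans (∑²-at-first (qz 0ℤ) (λ z y≈ → qz-cong (≈-refl {0ℤ}) y≈ (≈-refl {z})))
                     (∑ᵣ-[≡0]-* (q 0ℤ 0ℤ) (q-cong (≈-refl {0ℤ}) (≈-refl {0ℤ}))))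

  -- The surface Q(x, y, z) = d·x·y·z

  module Surface (a11 a22 a33 a12 a13 a23 d : ℤ)
                 (a11≉0 : a11 ≉ 0ℤ) (a22≉0 : a22 ≉ 0ℤ) (a33≉0 : a33 ≉ 0ℤ) (d≉0 : d ≉ 0ℤ) where

    E Q : ℤ → ℤ → ℤ → ℤ
    E = F a11 a22 a33 a12 a13 a23 d
    Q = F a11 a22 a33 a12 a13 a23 0ℤ

    [F≡0]-cong : ∀ e → Respects³ (λ x y z → [ F a11 a22 a33 a12 a13 a23 e x y z ≡0])
    [F≡0]-cong e x≈ y≈ z≈ = [≡0]-cong (F-cong (≈-refl {a11}) (≈-refl {a22}) (≈-refl {a33}) (≈-refl {a12})
                                              (≈-refl {a13}) (≈-refl {a23}) (≈-refl {e}) x≈ y≈ z≈)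

    N N₀ N₀-planes #points : ℤ
    N = ∑³ λ x y z → [ E x y z ≡0]
    N₀ = ∑³ λ x y z → [ Q x y z ≡0]
    N₀-planes = ∑³ λ x y z → [ x * y * z ≡0] * [ Q x y z ≡0]
    #points = ∑³ λ _ _ _ → 1ℤ

    E-on-line : ∀ t x y z → E (t * x) (t * y) (t * z) ≡ t * t * (- d * (x * y * z) * t + Q x y z)
    E-on-line t x y z = ring a11 a22 a33 a12 a13 a23 d x y z t
      where
      ring : ∀ a11 a22 a33 a12 a13 a23 d x y z t →
        a11 * (t * x) * (t * x) + a22 * (t * y) * (t * y) + a33 * (t * z) * (t * z) + a12 * (t * x) * (t * y)
          + a13 * (t * x) * (t * z) + a23 * (t * y) * (t * z) - d * (t * x) * (t * y) * (t * z)
        ≡ t * t * (- d * (x * y * z) * t + (a11 * x * x + a22 * y * y + a33 * z * z + a12 * x * y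
                                             + a13 * x * z + a23 * y * z - 0ℤ * x * y * z))
      ring = solve-∀

    line-roots : ∀ x y z →
      ∑ᵣ[ t ] [ - d * (x * y * z) * t + Q x y z ≡0] ≡ (1ℤ - [ x * y * z ≡0]) + + p * ([ x * y * z ≡0] * [ Q x y z ≡0])
    line-roots x y z with x * y * z ≈?0
    ... | yes xyz≈0 = begin
      ∑ᵣ[ t ] [ - d * (x * y * z) * t + Q x y z ≡0]   ≡⟨ ∑ᵣ-cong (λ t → [≡0]-cong (constant t)) ⟩
      ∑ᵣ[ t ] [ Q x y z ≡0]                           ≡⟨ ∑ᵣ-const [ Q x y z ≡0] ⟩
      + p * [ Q x y z ≡0]                             ≡⟨ ring (+ p) [ Q x y z ≡0] ⟩
      (1ℤ - 1ℤ) + + p * (1ℤ * [ Q x y z ≡0])          ≡⟨ cong (λ u → (1ℤ - u) + + p * (u * [ Q x y z ≡0])) (sym ([≡0]-≈0 xyz≈0)) ⟩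
      (1ℤ - [ x * y * z ≡0]) + + p * ([ x * y * z ≡0] * [ Q x y z ≡0]) ∎
      where
      open ≡-Reasoning
      ring : ∀ p q → p * q ≡ (1ℤ - 1ℤ) + p * (1ℤ * q)
      ring = solve-∀
      constant : ∀ t → - d * (x * y * z) * t + Q x y z ≈ Q x y z
      constant t = ≈-trans (+-cong (≈0-*ʳ t (≈0-*ˡ (- d) xyz≈0)) (≈-refl {Q x y z})) (≈-reflexive (+-identityˡ _))
    ... | no xyz≉0 = begin
      ∑ᵣ[ t ] [ - d * (x * y * z) * t + Q x y z ≡0]   ≡⟨ linear-root-count (Q x y z) (≉0-* (≉0-neg d≉0) xyz≉0) ⟩
      1ℤ                                              ≡⟨ ring (+ p) [ Q x y z ≡0] ⟩
      (1ℤ - 0ℤ) + + p * (0ℤ * [ Q x y z ≡0])          ≡⟨ cong (λ u → (1ℤ - u) + + p * (u * [ Q x y z ≡0])) (sym ([≡0]-≉0 xyz≉0)) ⟩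
      (1ℤ - [ x * y * z ≡0]) + + p * ([ x * y * z ≡0] * [ Q x y z ≡0]) ∎
      where
      open ≡-Reasoning
      ring : ∀ p q → 1ℤ ≡ (1ℤ - 0ℤ) + p * (0ℤ * q)
      ring = solve-∀

    line-count : ∀ x y z → ∑ᵣ[ t ] [ E (t * x) (t * y) (t * z) ≡0] ≡
      1ℤ + ((1ℤ - [ x * y * z ≡0]) + + p * ([ x * y * z ≡0] * [ Q x y z ≡0])) - [ Q x y z ≡0]
    line-count x y z = begin
      ∑ᵣ[ t ] [ E (t * x) (t * y) (t * z) ≡0]
        ≡⟨ ∑ᵣ-cong (λ t → trans (cong [_≡0] (E-on-line t x y z)) (on-line t)) ⟩
      ∑ᵣ[ t ] ([ t ≡0] + [ m * t + q ≡0] - [ t ≡0] * [ m * t + q ≡0])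
        ≡⟨ ∑ᵣ-- (λ t → [ t ≡0] + [ m * t + q ≡0]) (λ t → [ t ≡0] * [ m * t + q ≡0]) ⟩
      ∑ᵣ[ t ] ([ t ≡0] + [ m * t + q ≡0]) - ∑ᵣ[ t ] ([ t ≡0] * [ m * t + q ≡0])
        ≡⟨ cong₂ _-_ (trans (∑ᵣ-+ [_≡0] (λ t → [ m * t + q ≡0])) (cong₂ _+_ ∑ᵣ-[≡0] (line-roots x y z)))
                     (trans (∑ᵣ-[≡0]-* (λ t → [ m * t + q ≡0]) (λ t≈ → [≡0]-cong (+-cong (*-cong (≈-refl {m}) t≈) (≈-refl {q}))))
                            (cong [_≡0] (ring m q))) ⟩
      1ℤ + ((1ℤ - [ x * y * z ≡0]) + + p * ([ x * y * z ≡0] * [ Q x y z ≡0])) - [ Q x y z ≡0] ∎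
      where
      open ≡-Reasoning
      m = - d * (x * y * z)
      q = Q x y z
      ring : ∀ m q → m * 0ℤ + q ≡ q
      ring = solve-∀
      on-line : ∀ t → [ t * t * (m * t + q) ≡0] ≡ [ t ≡0] + [ m * t + q ≡0] - [ t ≡0] * [ m * t + q ≡0]
      on-line t = trans ([≡0]-* (t * t) (m * t + q)) (cong (λ u → u + [ m * t + q ≡0] - u * [ m * t + q ≡0]) ([≡0]-square t))

    double-count : #points + (+ p - 1ℤ) * N ≡ #points + ((+ p - 1ℤ) * (+ p - 1ℤ) * (+ p - 1ℤ) + + p * N₀-planes) - N₀
    double-count = begin
      #points + (+ p - 1ℤ) * N
        ≡⟨ sym (∑ᵣ-by-zero (λ t → ∑³ λ x y z → [ E (t * x) (t * y) (t * z) ≡0]) #points N on-zero off-zero) ⟩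
      ∑ᵣ[ t ] ∑³ (λ x y z → [ E (t * x) (t * y) (t * z) ≡0])
        ≡⟨ ∑³-comm-∑ᵣ (λ t x y z → [ E (t * x) (t * y) (t * z) ≡0]) ⟩
      ∑³ (λ x y z → ∑ᵣ[ t ] [ E (t * x) (t * y) (t * z) ≡0])
        ≡⟨ ∑³-cong line-count ⟩
      ∑³ (λ x y z → 1ℤ + (u x y z + + p * z₀ x y z) - [ Q x y z ≡0])
        ≡⟨ ∑³-- (λ x y z → 1ℤ + (u x y z + + p * z₀ x y z)) (λ x y z → [ Q x y z ≡0]) ⟩
      ∑³ (λ x y z → 1ℤ + (u x y z + + p * z₀ x y z)) - N₀
        ≡⟨ cong (_- N₀) (trans (∑³-+ (λ _ _ _ → 1ℤ) (λ x y z → u x y z + + p * z₀ x y z))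
                              (cong (_+_ #points) (trans (∑³-+ u (λ x y z → + p * z₀ x y z)) (cong₂ _+_ ∑³-u (∑³-*ˡ (+ p) z₀))))) ⟩
      #points + ((+ p - 1ℤ) * (+ p - 1ℤ) * (+ p - 1ℤ) + + p * N₀-planes) - N₀ ∎
      where
      open ≡-Reasoning
      u z₀ : ℤ → ℤ → ℤ → ℤ
      u x y z = 1ℤ - [ x * y * z ≡0]
      z₀ x y z = [ x * y * z ≡0] * [ Q x y z ≡0]
      on-zero : ∀ {t} → t ≈ 0ℤ → ∑³ (λ x y z → [ E (t * x) (t * y) (t * z) ≡0]) ≡ #points
      on-zero {t} t≈0 = ∑³-cong λ x y z →
        [≡0]-≈0 (≈-trans (≈-reflexive (E-on-line t x y z)) (≈0-*ʳ _ (≈0-*ʳ t t≈0)))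
      off-zero : ∀ {t} → t ≉ 0ℤ → ∑³ (λ x y z → [ E (t * x) (t * y) (t * z) ≡0]) ≡ N
      off-zero t≉0 = ∑³-scale (λ x y z → [ E x y z ≡0]) t≉0 ([F≡0]-cong d)
      factorise : ∀ x y z → u x y z ≡ (1ℤ - [ x ≡0]) * (1ℤ - [ y ≡0]) * (1ℤ - [ z ≡0])
      factorise x y z = trans (cong (_-_ 1ℤ) (trans ([≡0]-* (x * y) z) (cong (λ w → w + [ z ≡0] - w * [ z ≡0]) ([≡0]-* x y))))
                              (ring [ x ≡0] [ y ≡0] [ z ≡0])
        where
        ring : ∀ X Y Z → 1ℤ - (X + Y - X * Y + Z - (X + Y - X * Y) * Z) ≡ (1ℤ - X) * (1ℤ - Y) * (1ℤ - Z)
        ring = solve-∀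
      ∑³-u : ∑³ u ≡ (+ p - 1ℤ) * (+ p - 1ℤ) * (+ p - 1ℤ)
      ∑³-u = trans (∑³-cong factorise)
            (trans (∑³-product (λ x → 1ℤ - [ x ≡0]) (λ y → 1ℤ - [ y ≡0]) (λ z → 1ℤ - [ z ≡0]))
                   (cong (λ s → s * s * s) ∑ᵣ-units))

    open BinaryForm (a13 * a13 - + 4 * a11 * a33) (+ 2 * a13 * a23 - + 4 * a33 * a12) (a23 * a23 - + 4 * a22 * a33)
      public using (discriminant; form; character-sum; character-sum-nondegenerate; character-sum-degenerate; character-sum-degenerate-γ≈0)

    c₁ c₂ c₃ : ℤ
    c₁ = χ (a23 * a23 - + 4 * a22 * a33)
    c₂ = χ (a13 * a13 - + 4 * a11 * a33)
    c₃ = χ (a12 * a12 - + 4 * a11 * a22)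

    N₀≡ : N₀ ≡ + p * (+ p * 1ℤ) + character-sum
    N₀≡ = begin
      N₀                                                  ≡⟨ ∑ᵣ-cong (λ x → ∑ᵣ-cong (λ y → roots-in-z x y)) ⟩
      ∑ᵣ[ x ] ∑ᵣ[ y ] (1ℤ + χ (form x y))                ≡⟨ ∑ᵣ-cong (λ x → ∑ᵣ-+ (λ _ → 1ℤ) (λ y → χ (form x y))) ⟩
      ∑ᵣ[ x ] (∑ᵣ[ _ ] 1ℤ + ∑ᵣ[ y ] χ (form x y))        ≡⟨ ∑ᵣ-+ (λ _ → ∑ᵣ[ _ ] 1ℤ) (λ x → ∑ᵣ[ y ] χ (form x y)) ⟩
      ∑ᵣ[ _ ] ∑ᵣ[ _ ] 1ℤ + character-sum                 ≡⟨ cong (_+ character-sum) (trans (∑ᵣ-cong (λ _ → ∑ᵣ-const 1ℤ)) (∑ᵣ-const _)) ⟩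
      + p * (+ p * 1ℤ) + character-sum                   ∎
      where
      open ≡-Reasoning
      roots-in-z : ∀ x y → ∑ᵣ[ z ] [ Q x y z ≡0] ≡ 1ℤ + χ (form x y)
      roots-in-z x y = trans (∑ᵣ-cong (λ z → cong [_≡0] (ring a11 a22 a33 a12 a13 a23 x y z)))
                      (trans (quadratic-root-count (a13 * x + a23 * y) (a11 * x * x + a12 * x * y + a22 * y * y) a33≉0)
                             (cong (λ t → 1ℤ + χ t) (ring′ a11 a22 a33 a12 a13 a23 x y)))
        where
        ring : ∀ a11 a22 a33 a12 a13 a23 x y z →
          a11 * x * x + a22 * y * y + a33 * z * z + a12 * x * y + a13 * x * z + a23 * y * z - 0ℤ * x * y * z
          ≡ a33 * z * z + (a13 * x + a23 * y) * z + (a11 * x * x + a12 * x * y + a22 * y * y)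
        ring = solve-∀
        ring′ : ∀ a11 a22 a33 a12 a13 a23 x y →
          (a13 * x + a23 * y) * (a13 * x + a23 * y) - + 4 * a33 * (a11 * x * x + a12 * x * y + a22 * y * y)
          ≡ (a13 * a13 - + 4 * a11 * a33) * x * x + (+ 2 * a13 * a23 - + 4 * a33 * a12) * x * y
            + (a23 * a23 - + 4 * a22 * a33) * y * y
        ring′ = solve-∀

    zeros-on-plane-x : ∑ᵣ[ y ] ∑ᵣ[ z ] [ Q 0ℤ y z ≡0] ≡ + p + (+ p - 1ℤ) * c₁
    zeros-on-plane-x = trans (∑ᵣ-cong λ y → ∑ᵣ-cong λ z → cong [_≡0] (ring a11 a22 a33 a12 a13 a23 y z))
      (binary-form-zero-count a22 a23 a33≉0)
      where
      ring : ∀ a11 a22 a33 a12 a13 a23 y z →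
        a11 * 0ℤ * 0ℤ + a22 * y * y + a33 * z * z + a12 * 0ℤ * y + a13 * 0ℤ * z + a23 * y * z - 0ℤ * 0ℤ * y * z
        ≡ a22 * y * y + a23 * y * z + a33 * z * z
      ring = solve-∀

    zeros-on-plane-y : ∑ᵣ[ x ] ∑ᵣ[ z ] [ Q x 0ℤ z ≡0] ≡ + p + (+ p - 1ℤ) * c₂
    zeros-on-plane-y = trans (∑ᵣ-cong λ x → ∑ᵣ-cong λ z → cong [_≡0] (ring a11 a22 a33 a12 a13 a23 x z))
      (binary-form-zero-count a11 a13 a33≉0)
      where
      ring : ∀ a11 a22 a33 a12 a13 a23 x z →
        a11 * x * x + a22 * 0ℤ * 0ℤ + a33 * z * z + a12 * x * 0ℤ + a13 * x * z + a23 * 0ℤ * z - 0ℤ * x * 0ℤ * z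
        ≡ a11 * x * x + a13 * x * z + a33 * z * z
      ring = solve-∀

    zeros-on-plane-z : ∑ᵣ[ x ] ∑ᵣ[ y ] [ Q x y 0ℤ ≡0] ≡ + p + (+ p - 1ℤ) * c₃
    zeros-on-plane-z = trans (∑ᵣ-cong λ x → ∑ᵣ-cong λ y → cong [_≡0] (ring a11 a22 a33 a12 a13 a23 x y))
      (binary-form-zero-count a11 a12 a22≉0)
      where
      ring : ∀ a11 a22 a33 a12 a13 a23 x y →
        a11 * x * x + a22 * y * y + a33 * 0ℤ * 0ℤ + a12 * x * y + a13 * x * 0ℤ + a23 * y * 0ℤ - 0ℤ * x * y * 0ℤ
        ≡ a11 * x * x + a12 * x * y + a22 * y * y
      ring = solve-∀

    zeros-on-axis-z : ∑ᵣ[ z ] [ Q 0ℤ 0ℤ z ≡0] ≡ 1ℤ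
    zeros-on-axis-z = trans (∑ᵣ-cong λ z → cong [_≡0] (ring a11 a22 a33 a12 a13 a23 z)) (∑ᵣ-[c·z²≡0] a33≉0)
      where
      ring : ∀ a11 a22 a33 a12 a13 a23 z →
        a11 * 0ℤ * 0ℤ + a22 * 0ℤ * 0ℤ + a33 * z * z + a12 * 0ℤ * 0ℤ + a13 * 0ℤ * z + a23 * 0ℤ * z - 0ℤ * 0ℤ * 0ℤ * z
        ≡ a33 * (z * z)
      ring = solve-∀

    zeros-on-axis-y : ∑ᵣ[ y ] [ Q 0ℤ y 0ℤ ≡0] ≡ 1ℤ
    zeros-on-axis-y = trans (∑ᵣ-cong λ y → cong [_≡0] (ring a11 a22 a33 a12 a13 a23 y)) (∑ᵣ-[c·z²≡0] a22≉0)
      where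
      ring : ∀ a11 a22 a33 a12 a13 a23 y →
        a11 * 0ℤ * 0ℤ + a22 * y * y + a33 * 0ℤ * 0ℤ + a12 * 0ℤ * y + a13 * 0ℤ * 0ℤ + a23 * y * 0ℤ - 0ℤ * 0ℤ * y * 0ℤ
        ≡ a22 * (y * y)
      ring = solve-∀

    zeros-on-axis-x : ∑ᵣ[ x ] [ Q x 0ℤ 0ℤ ≡0] ≡ 1ℤ
    zeros-on-axis-x = trans (∑ᵣ-cong λ x → cong [_≡0] (ring a11 a22 a33 a12 a13 a23 x)) (∑ᵣ-[c·z²≡0] a11≉0)
      where
      ring : ∀ a11 a22 a33 a12 a13 a23 x →
        a11 * x * x + a22 * 0ℤ * 0ℤ + a33 * 0ℤ * 0ℤ + a12 * x * 0ℤ + a13 * x * 0ℤ + a23 * 0ℤ * 0ℤ - 0ℤ * x * 0ℤ * 0ℤ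
        ≡ a11 * (x * x)
      ring = solve-∀

    zero-at-origin : [ Q 0ℤ 0ℤ 0ℤ ≡0] ≡ 1ℤ
    zero-at-origin = [≡0]-≈0 (≈-reflexive (ring a11 a22 a33 a12 a13 a23))
      where
      ring : ∀ a11 a22 a33 a12 a13 a23 →
        a11 * 0ℤ * 0ℤ + a22 * 0ℤ * 0ℤ + a33 * 0ℤ * 0ℤ + a12 * 0ℤ * 0ℤ + a13 * 0ℤ * 0ℤ + a23 * 0ℤ * 0ℤ - 0ℤ * 0ℤ * 0ℤ * 0ℤ
        ≡ 0ℤ
      ring = solve-∀

    N₀-planes≡ : N₀-planes ≡ + p + (+ p - 1ℤ) * c₁ + (+ p + (+ p - 1ℤ) * c₂) + (+ p + (+ p - 1ℤ) * c₃) - 1ℤ - 1ℤ - 1ℤ + 1ℤ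
    N₀-planes≡ = begin
      N₀-planes
        ≡⟨ ∑³-inclusion-exclusion (λ x y z → [ Q x y z ≡0]) ([F≡0]-cong 0ℤ) ⟩
      ∑ᵣ[ y ] ∑ᵣ[ z ] [ Q 0ℤ y z ≡0] + ∑ᵣ[ x ] ∑ᵣ[ z ] [ Q x 0ℤ z ≡0] + ∑ᵣ[ x ] ∑ᵣ[ y ] [ Q x y 0ℤ ≡0]
        - ∑ᵣ[ z ] [ Q 0ℤ 0ℤ z ≡0] - ∑ᵣ[ y ] [ Q 0ℤ y 0ℤ ≡0] - ∑ᵣ[ x ] [ Q x 0ℤ 0ℤ ≡0] + [ Q 0ℤ 0ℤ 0ℤ ≡0]
        ≡⟨ cong (λ s → s - ∑ᵣ[ z ] [ Q 0ℤ 0ℤ z ≡0] - ∑ᵣ[ y ] [ Q 0ℤ y 0ℤ ≡0] - ∑ᵣ[ x ] [ Q x 0ℤ 0ℤ ≡0] + [ Q 0ℤ 0ℤ 0ℤ ≡0])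
                (cong₂ _+_ (cong₂ _+_ zeros-on-plane-x zeros-on-plane-y) zeros-on-plane-z) ⟩
      planes - ∑ᵣ[ z ] [ Q 0ℤ 0ℤ z ≡0] - ∑ᵣ[ y ] [ Q 0ℤ y 0ℤ ≡0] - ∑ᵣ[ x ] [ Q x 0ℤ 0ℤ ≡0] + [ Q 0ℤ 0ℤ 0ℤ ≡0]
        ≡⟨ cong₂ (λ s t → planes - s - t - ∑ᵣ[ x ] [ Q x 0ℤ 0ℤ ≡0] + [ Q 0ℤ 0ℤ 0ℤ ≡0]) zeros-on-axis-z zeros-on-axis-y ⟩
      planes - 1ℤ - 1ℤ - ∑ᵣ[ x ] [ Q x 0ℤ 0ℤ ≡0] + [ Q 0ℤ 0ℤ 0ℤ ≡0]
        ≡⟨ cong₂ (λ s t → planes - 1ℤ - 1ℤ - s + t) zeros-on-axis-x zero-at-origin ⟩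
      planes - 1ℤ - 1ℤ - 1ℤ + 1ℤ ∎
      where
      open ≡-Reasoning
      planes = + p + (+ p - 1ℤ) * c₁ + (+ p + (+ p - 1ℤ) * c₂) + (+ p + (+ p - 1ℤ) * c₃)

    solution-count : ∀ τ → character-sum ≡ (+ p - 1ℤ) * τ → N ≡ + p * + p + (c₁ + c₂ + c₃) * + p + 1ℤ - τ
    solution-count τ character-sum≡ = *-cancelˡ-≡ (+ p - 1ℤ) N _ {{≢-nonZero p-1≢0}} (begin
      (+ p - 1ℤ) * N
        ≡⟨ ring₁ #points ((+ p - 1ℤ) * N) ⟩
      #points + (+ p - 1ℤ) * N - #points
        ≡⟨ cong (_- #points) double-count ⟩
      #points + ((+ p - 1ℤ) * (+ p - 1ℤ) * (+ p - 1ℤ) + + p * N₀-planes) - N₀ - #points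
        ≡⟨ cong₂ (λ Z C → #points + ((+ p - 1ℤ) * (+ p - 1ℤ) * (+ p - 1ℤ) + + p * Z) - C - #points)
                 N₀-planes≡ (trans N₀≡ (cong (_+_ (+ p * (+ p * 1ℤ))) character-sum≡)) ⟩
      #points + ((+ p - 1ℤ) * (+ p - 1ℤ) * (+ p - 1ℤ) + + p * (+ p + (+ p - 1ℤ) * c₁ + (+ p + (+ p - 1ℤ) * c₂)
        + (+ p + (+ p - 1ℤ) * c₃) - 1ℤ - 1ℤ - 1ℤ + 1ℤ)) - (+ p * (+ p * 1ℤ) + (+ p - 1ℤ) * τ) - #points
        ≡⟨ ring₂ (+ p) #points c₁ c₂ c₃ τ ⟩
      (+ p - 1ℤ) * (+ p * + p + (c₁ + c₂ + c₃) * + p + 1ℤ - τ)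
        ∎)
      where
      open ≡-Reasoning
      p-1≢0 : + p - 1ℤ ≢ 0ℤ
      p-1≢0 p-1≡0 = ℕ.<-irrefl (sym (+-injective (trans (ring₀ (+ p)) (cong (_+ 1ℤ) p-1≡0)))) (ℕ.<-trans (ℕ.s≤s (ℕ.s≤s ℕ.z≤n)) 2<p)
        where
        ring₀ : ∀ p → p ≡ p - 1ℤ + 1ℤ
        ring₀ = solve-∀
      ring₁ : ∀ k n → n ≡ k + n - k
      ring₁ = solve-∀
      ring₂ : ∀ p K c₁ c₂ c₃ τ →
        K + ((p - 1ℤ) * (p - 1ℤ) * (p - 1ℤ) + p * (p + (p - 1ℤ) * c₁ + (p + (p - 1ℤ) * c₂) + (p + (p - 1ℤ) * c₃) - 1ℤ - 1ℤ - 1ℤ + 1ℤ))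
          - (p * (p * 1ℤ) + (p - 1ℤ) * τ) - K
        ≡ (p - 1ℤ) * (p * p + (c₁ + c₂ + c₃) * p + 1ℤ - τ)
      ring₂ = solve-∀

    D A₁ A₂ A₃ C₁₂ C₁₃ C₂₃ : ℤ
    D = detG a11 a22 a33 a12 a13 a23
    A₁ = A11 a11 a22 a33 a12 a13 a23
    A₂ = A22 a11 a22 a33 a12 a13 a23
    A₃ = A33 a11 a22 a33 a12 a13 a23
    C₁₂ = a13 * a23 - + 2 * a12 * a33
    C₁₃ = a12 * a23 - + 2 * a22 * a13
    C₂₃ = a12 * a13 - + 2 * a11 * a23

    adjugate₁₂ : D ≈ 0ℤ → A₁ * A₂ ≈ C₁₂ * C₁₂
    adjugate₁₂ D≈0 = sub≈0⇒≈ (≈-trans (≈-reflexive (ring a11 a22 a33 a12 a13 a23)) (≈0-*ˡ (+ 2 * a33) D≈0))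
      where
      ring : ∀ a11 a22 a33 a12 a13 a23 →
        (+ 4 * a22 * a33 - a23 * a23) * (+ 4 * a11 * a33 - a13 * a13) - (a13 * a23 - + 2 * a12 * a33) * (a13 * a23 - + 2 * a12 * a33)
        ≡ + 2 * a33 * ((+ 2 * a11) * ((+ 2 * a22) * (+ 2 * a33) - a23 * a23) - a12 * (a12 * (+ 2 * a33) - a23 * a13)
                         + a13 * (a12 * a23 - (+ 2 * a22) * a13))
      ring = solve-∀

    adjugate₁₃ : D ≈ 0ℤ → A₁ * A₃ ≈ C₁₃ * C₁₃
    adjugate₁₃ D≈0 = sub≈0⇒≈ (≈-trans (≈-reflexive (ring a11 a22 a33 a12 a13 a23)) (≈0-*ˡ (+ 2 * a22) D≈0))
      where
      ring : ∀ a11 a22 a33 a12 a13 a23 →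
        (+ 4 * a22 * a33 - a23 * a23) * (+ 4 * a11 * a22 - a12 * a12) - (a12 * a23 - + 2 * a22 * a13) * (a12 * a23 - + 2 * a22 * a13)
        ≡ + 2 * a22 * ((+ 2 * a11) * ((+ 2 * a22) * (+ 2 * a33) - a23 * a23) - a12 * (a12 * (+ 2 * a33) - a23 * a13)
                         + a13 * (a12 * a23 - (+ 2 * a22) * a13))
      ring = solve-∀

    adjugate₂₃ : D ≈ 0ℤ → A₂ * A₃ ≈ C₂₃ * C₂₃
    adjugate₂₃ D≈0 = sub≈0⇒≈ (≈-trans (≈-reflexive (ring a11 a22 a33 a12 a13 a23)) (≈0-*ˡ (+ 2 * a11) D≈0))
      where
      ring : ∀ a11 a22 a33 a12 a13 a23 →
        (+ 4 * a11 * a33 - a13 * a13) * (+ 4 * a11 * a22 - a12 * a12) - (a12 * a13 - + 2 * a11 * a23) * (a12 * a13 - + 2 * a11 * a23)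
        ≡ + 2 * a11 * ((+ 2 * a11) * ((+ 2 * a22) * (+ 2 * a33) - a23 * a23) - a12 * (a12 * (+ 2 * a33) - a23 * a13)
                         + a13 * (a12 * a23 - (+ 2 * a22) * a13))
      ring = solve-∀

    vanishing-minor : ∀ {A A′ c} → A * A′ ≈ c * c → A ≈ 0ℤ → c ≈ 0ℤ
    vanishing-minor {A} {A′} AA′≈c² A≈0 = square-≈0⇒≈0 (≈-trans (≈-sym AA′≈c²) (≈0-*ʳ A′ A≈0))

    third-cofactor-vanishes : ∀ {A a u v c c′} → + 2 * a ≉ 0ℤ → u * c + v * c′ + + 2 * a * A ≡ D →
      D ≈ 0ℤ → c ≈ 0ℤ → c′ ≈ 0ℤ → A ≈ 0ℤ
    third-cofactor-vanishes {A} {a} {u} {v} {c} {c′} 2a≉0 expansion D≈0 c≈0 c′≈0 = ≉0-cancelˡ 2a≉0 (begin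
      + 2 * a * A                                   ≈⟨ ≈-reflexive (ring (u * c) (v * c′) (+ 2 * a * A)) ⟩
      u * c + v * c′ + + 2 * a * A - u * c - v * c′ ≈⟨ sub-cong (sub-cong (≈-reflexive expansion) (≈0-*ˡ u c≈0)) (≈0-*ˡ v c′≈0) ⟩
      D - 0ℤ - 0ℤ                                   ≈⟨ sub-cong (sub-cong D≈0 (≈-refl {0ℤ})) (≈-refl {0ℤ}) ⟩
      0ℤ                                            ∎)
      where
      open ≈-Reasoning
      ring : ∀ x y z → z ≡ x + y + z - x - y
      ring = solve-∀

    A₁-vanishes : D ≈ 0ℤ → A₂ ≈ 0ℤ → A₃ ≈ 0ℤ → A₁ ≈ 0ℤ
    A₁-vanishes D≈0 A₂≈0 A₃≈0 = third-cofactor-vanishes {A₁} {a11} {a12} {a13} {C₁₂} {C₁₃} (≉0-* 2≉0 a11≉0) (ring a11 a22 a33 a12 a13 a23) D≈0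
      (vanishing-minor (≈-trans (≈-reflexive (*-comm A₂ A₁)) (adjugate₁₂ D≈0)) A₂≈0)
      (vanishing-minor (≈-trans (≈-reflexive (*-comm A₃ A₁)) (adjugate₁₃ D≈0)) A₃≈0)
      where
      ring : ∀ a11 a22 a33 a12 a13 a23 →
        a12 * (a13 * a23 - + 2 * a12 * a33) + a13 * (a12 * a23 - + 2 * a22 * a13) + + 2 * a11 * (+ 4 * a22 * a33 - a23 * a23)
        ≡ (+ 2 * a11) * ((+ 2 * a22) * (+ 2 * a33) - a23 * a23) - a12 * (a12 * (+ 2 * a33) - a23 * a13)
            + a13 * (a12 * a23 - (+ 2 * a22) * a13)
      ring = solve-∀

    A₂-vanishes : D ≈ 0ℤ → A₁ ≈ 0ℤ → A₃ ≈ 0ℤ → A₂ ≈ 0ℤ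
    A₂-vanishes D≈0 A₁≈0 A₃≈0 = third-cofactor-vanishes {A₂} {a22} {a12} {a23} {C₁₂} {C₂₃} (≉0-* 2≉0 a22≉0)
      (ring a11 a22 a33 a12 a13 a23) D≈0
      (vanishing-minor (adjugate₁₂ D≈0) A₁≈0)
      (vanishing-minor (≈-trans (≈-reflexive (*-comm A₃ A₂)) (adjugate₂₃ D≈0)) A₃≈0)
      where
      ring : ∀ a11 a22 a33 a12 a13 a23 →
        a12 * (a13 * a23 - + 2 * a12 * a33) + a23 * (a12 * a13 - + 2 * a11 * a23) + + 2 * a22 * (+ 4 * a11 * a33 - a13 * a13)
        ≡ (+ 2 * a11) * ((+ 2 * a22) * (+ 2 * a33) - a23 * a23) - a12 * (a12 * (+ 2 * a33) - a23 * a13)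
            + a13 * (a12 * a23 - (+ 2 * a22) * a13)
      ring = solve-∀

    A₃-vanishes : D ≈ 0ℤ → A₁ ≈ 0ℤ → A₂ ≈ 0ℤ → A₃ ≈ 0ℤ
    A₃-vanishes D≈0 A₁≈0 A₂≈0 = third-cofactor-vanishes {A₃} {a33} {a13} {a23} {C₁₃} {C₂₃} (≉0-* 2≉0 a33≉0)
      (ring a11 a22 a33 a12 a13 a23) D≈0
      (vanishing-minor (adjugate₁₃ D≈0) A₁≈0)
      (vanishing-minor (adjugate₂₃ D≈0) A₂≈0)
      where
      ring : ∀ a11 a22 a33 a12 a13 a23 →
        a13 * (a12 * a23 - + 2 * a22 * a13) + a23 * (a12 * a13 - + 2 * a11 * a23) + + 2 * a33 * (+ 4 * a11 * a22 - a12 * a12)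
        ≡ (+ 2 * a11) * ((+ 2 * a22) * (+ 2 * a33) - a23 * a23) - a12 * (a12 * (+ 2 * a33) - a23 * a13)
            + a13 * (a12 * a23 - (+ 2 * a22) * a13)
      ring = solve-∀

    discriminant≡-cofactor : ∀ a b c → c * c - + 4 * a * b ≡ - (+ 4 * a * b - c * c)
    discriminant≡-cofactor = solve-∀

    χ-neg-A₁ : c₁ ≡ χ (- A₁)
    χ-neg-A₁ = cong χ (discriminant≡-cofactor a22 a33 a23)

    χ-neg-A₂ : c₂ ≡ χ (- A₂)
    χ-neg-A₂ = cong χ (discriminant≡-cofactor a11 a33 a13)

    χ-neg-A₃ : c₃ ≡ χ (- A₃)
    χ-neg-A₃ = cong χ (discriminant≡-cofactor a11 a22 a12)

    Lsum : ℤ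
    Lsum = χ (- A₁) + χ (- A₂) + χ (- A₃)

    c-sum : c₁ + c₂ + c₃ ≡ Lsum
    c-sum = cong₂ _+_ (cong₂ _+_ χ-neg-A₁ χ-neg-A₂) χ-neg-A₃

    discriminant≡ : discriminant ≡ - (+ 8 * a33 * D)
    discriminant≡ = ring a11 a22 a33 a12 a13 a23
      where
      ring : ∀ a11 a22 a33 a12 a13 a23 →
        (+ 2 * a13 * a23 - + 4 * a33 * a12) * (+ 2 * a13 * a23 - + 4 * a33 * a12)
          - + 4 * (a13 * a13 - + 4 * a11 * a33) * (a23 * a23 - + 4 * a22 * a33)
        ≡ - (+ 8 * a33 * ((+ 2 * a11) * ((+ 2 * a22) * (+ 2 * a33) - a23 * a23) - a12 * (a12 * (+ 2 * a33) - a23 * a13)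
                            + a13 * (a12 * a23 - (+ 2 * a22) * a13)))
      ring = solve-∀

    discriminant-≈0 : D ≈ 0ℤ → discriminant ≈ 0ℤ
    discriminant-≈0 D≈0 = ≈-trans (≈-reflexive discriminant≡) (-‿cong (≈0-*ˡ (+ 8 * a33) D≈0))

    discriminant-≉0 : D ≉ 0ℤ → discriminant ≉ 0ℤ
    discriminant-≉0 D≉0 δ≈0 = D≉0 (≉0-cancelˡ (≉0-* (≉0-* 2≉0 4≉0) a33≉0)
      (≈-trans (≈-reflexive (sym (neg-involutive _))) (-‿cong (≈-trans (≈-reflexive (sym discriminant≡)) δ≈0))))

    count-nondegenerate : D ≉ 0ℤ → N ≡ + p * + p + Lsum * + p + 1ℤ
    count-nondegenerate D≉0 = begin
      N                                                ≡⟨ solution-count 0ℤ (trans (character-sum-nondegenerate (discriminant-≉0 D≉0))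
                                                                                   (sym (*-zeroʳ (+ p - 1ℤ)))) ⟩
      + p * + p + (c₁ + c₂ + c₃) * + p + 1ℤ - 0ℤ       ≡⟨ cong (λ L → + p * + p + L * + p + 1ℤ - 0ℤ) c-sum ⟩
      + p * + p + Lsum * + p + 1ℤ - 0ℤ                 ≡⟨ +-identityʳ _ ⟩
      + p * + p + Lsum * + p + 1ℤ                      ∎
      where open ≡-Reasoning

    count-degenerate : ∀ c s → character-sum ≡ (+ p - 1ℤ) * (+ p * c) → c ≡ s → N ≡ + p * + p + (Lsum - s) * + p + 1ℤ
    count-degenerate c s character-sum≡ c≡s = begin
      N                                                ≡⟨ solution-count (+ p * c) character-sum≡ ⟩
      + p * + p + (c₁ + c₂ + c₃) * + p + 1ℤ - + p * c  ≡⟨ cong₂ (λ L c → + p * + p + L * + p + 1ℤ - + p * c) c-sum c≡s ⟩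
      + p * + p + Lsum * + p + 1ℤ - + p * s            ≡⟨ ring (+ p) Lsum s ⟩
      + p * + p + (Lsum - s) * + p + 1ℤ                ∎
      where
      open ≡-Reasoning
      ring : ∀ p L s → p * p + L * p + 1ℤ - p * s ≡ p * p + (L - s) * p + 1ℤ
      ring = solve-∀

    count-all-cofactors-vanish : D ≈ 0ℤ → A₁ ≈ 0ℤ → A₂ ≈ 0ℤ → A₃ ≈ 0ℤ → N ≡ + p * + p + 1ℤ
    count-all-cofactors-vanish D≈0 A₁≈0 A₂≈0 A₃≈0 = begin
      N                                ≡⟨ count-degenerate c₂ 0ℤ (character-sum-degenerate-γ≈0 (discriminant-≈0 D≈0) γ≈0)
                                                                  (trans χ-neg-A₂ (χ-≈0 (-‿cong A₂≈0))) ⟩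
      + p * + p + (Lsum - 0ℤ) * + p + 1ℤ ≡⟨ cong (λ L → + p * + p + (L - 0ℤ) * + p + 1ℤ) Lsum≡0 ⟩
      + p * + p + 0ℤ * + p + 1ℤ        ≡⟨ cong (λ t → + p * + p + t + 1ℤ) (*-zeroˡ (+ p)) ⟩
      + p * + p + 0ℤ + 1ℤ              ≡⟨ cong (_+ 1ℤ) (+-identityʳ (+ p * + p)) ⟩
      + p * + p + 1ℤ                   ∎
      where
      open ≡-Reasoning
      γ≈0 = ≈-trans (≈-reflexive (discriminant≡-cofactor a22 a33 a23)) (-‿cong A₁≈0)
      Lsum≡0 : Lsum ≡ 0ℤ
      Lsum≡0 = cong₂ _+_ (cong₂ _+_ (χ-≈0 (-‿cong A₁≈0)) (χ-≈0 (-‿cong A₂≈0))) (χ-≈0 (-‿cong A₃≈0))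

    TwoCofactorsVanish : Set
    TwoCofactorsVanish = (A₁ ≈ 0ℤ × A₂ ≈ 0ℤ) ⊎ (A₁ ≈ 0ℤ × A₃ ≈ 0ℤ) ⊎ (A₂ ≈ 0ℤ × A₃ ≈ 0ℤ)

    count-two-cofactors-vanish : D ≈ 0ℤ → TwoCofactorsVanish → N ≡ + p * + p + 1ℤ
    count-two-cofactors-vanish D≈0 (inj₁ (A₁≈0 , A₂≈0)) =
      count-all-cofactors-vanish D≈0 A₁≈0 A₂≈0 (A₃-vanishes D≈0 A₁≈0 A₂≈0)
    count-two-cofactors-vanish D≈0 (inj₂ (inj₁ (A₁≈0 , A₃≈0))) =
      count-all-cofactors-vanish D≈0 A₁≈0 (A₂-vanishes D≈0 A₁≈0 A₃≈0) A₃≈0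
    count-two-cofactors-vanish D≈0 (inj₂ (inj₂ (A₂≈0 , A₃≈0))) =
      count-all-cofactors-vanish D≈0 (A₁-vanishes D≈0 A₂≈0 A₃≈0) A₂≈0 A₃≈0

    count-at-most-one-cofactor-vanishes : D ≈ 0ℤ → ¬ TwoCofactorsVanish → ∀ j → Ajj a11 a22 a33 a12 a13 a23 j ≉ 0ℤ →
      N ≡ + p * + p + (Lsum - χ (- Ajj a11 a22 a33 a12 a13 a23 j)) * + p + 1ℤ
    count-at-most-one-cofactor-vanishes D≈0 ¬two j Aj≉0 with A₁ ≈?0
    ... | no A₁≉0 = count-degenerate c₁ _ (character-sum-degenerate δ≈0 γ≉0) (selected j Aj≉0)
      where
      δ≈0 = discriminant-≈0 D≈0
      γ≉0 : a23 * a23 - + 4 * a22 * a33 ≉ 0ℤ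
      γ≉0 γ≈0 = ≉0-neg A₁≉0 (≈-trans (≈-reflexive (sym (discriminant≡-cofactor a22 a33 a23))) γ≈0)
      selected : ∀ j → Ajj a11 a22 a33 a12 a13 a23 j ≉ 0ℤ → c₁ ≡ χ (- Ajj a11 a22 a33 a12 a13 a23 j)
      selected 0F _ = χ-neg-A₁
      selected 1F A₂≉0 = trans χ-neg-A₁ (χ-neg-product-square C₁₂ (adjugate₁₂ D≈0) A₁≉0 A₂≉0)
      selected 2F A₃≉0 = trans χ-neg-A₁ (χ-neg-product-square C₁₃ (adjugate₁₃ D≈0) A₁≉0 A₃≉0)
    ... | yes A₁≈0 = count-degenerate c₂ _ (character-sum-degenerate-γ≈0 δ≈0 γ≈0) (selected j Aj≉0)
      where
      δ≈0 = discriminant-≈0 D≈0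
      γ≈0 = ≈-trans (≈-reflexive (discriminant≡-cofactor a22 a33 a23)) (-‿cong A₁≈0)
      A₂≉0 : A₂ ≉ 0ℤ
      A₂≉0 A₂≈0 = ¬two (inj₁ (A₁≈0 , A₂≈0))
      selected : ∀ j → Ajj a11 a22 a33 a12 a13 a23 j ≉ 0ℤ → c₂ ≡ χ (- Ajj a11 a22 a33 a12 a13 a23 j)
      selected 0F A₁≉0 = ⊥-elim (A₁≉0 A₁≈0)
      selected 1F _ = χ-neg-A₂
      selected 2F A₃≉0 = trans χ-neg-A₂ (χ-neg-product-square C₂₃ (adjugate₂₃ D≈0) A₂≉0 A₃≉0)

prime-2-or-odd : ∀ {p} → Prime p → p ≡ 2 ⊎ 2 < p
prime-2-or-odd {p} p-prime with ℕ.m≤n⇒m<n∨m≡n (ℕ.nonTrivial⇒n>1 p {{prime⇒nonTrivial p-prime}})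
... | inj₁ 2<p = inj₂ 2<p
... | inj₂ 2≡p = inj₁ (sym 2≡p)

theorem1p6 : (a11 a22 a33 a12 a13 a23 d : ℤ) (p : ℕ) → Prime p →
    ¬ ((+ p) ∣ (a11 * a22 * a33 * d)) →
    let D = detG a11 a22 a33 a12 a13 a23
        B11 = A11 a11 a22 a33 a12 a13 a23
        B22 = A22 a11 a22 a33 a12 a13 a23
        B33 = A33 a11 a22 a33 a12 a13 a23
        L = λ (j : Fin 3) → legendre (- Ajj a11 a22 a33 a12 a13 a23 j) p
        N = + solCount a11 a22 a33 a12 a13 a23 d p
        P = + p
        atLeastTwo = ((P ∣ B11) × (P ∣ B22)) ⊎ ((P ∣ B11) × (P ∣ B33)) ⊎ ((P ∣ B22) × (P ∣ B33))
        Lsum = legendre (- B11) p + legendre (- B22) p + legendre (- B33) p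
    in
    -- (1)
    (¬ (P ∣ D) → (2 < p) × (N ≡ P * P + Lsum * P + 1ℤ))
    -- (2)
    × (2 < p → P ∣ D → atLeastTwo → N ≡ P * P + 1ℤ)
    -- (3)
    × (2 < p → P ∣ D → ¬ atLeastTwo → (j : Fin 3) → ¬ (P ∣ Ajj a11 a22 a33 a12 a13 a23 j) →
         N ≡ P * P + (Lsum - L j) * P + 1ℤ)
    -- (4)
    × (p ≡ 2 → P ∣ D →
         (((+ 2 ∣ a12) × (+ 2 ∣ a13) × (+ 2 ∣ a23)) → N ≡ + 5)
       × ((¬ (+ 2 ∣ a12) × ¬ (+ 2 ∣ a13) × ¬ (+ 2 ∣ a23)) → N ≡ + 1)
       × (¬ ((+ 2 ∣ a12) × (+ 2 ∣ a13) × (+ 2 ∣ a23)) →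
          ¬ (¬ (+ 2 ∣ a12) × ¬ (+ 2 ∣ a13) × ¬ (+ 2 ∣ a23)) → N ≡ + 3))
theorem1p6 a11 a22 a33 a12 a13 a23 d p p-prime p∤a₁₁a₂₂a₃₃d with prime-2-or-odd p-prime
... | inj₁ refl =
  let open Parity
      a11≉0 , a22≉0 , a33≉0 , d≉0 = Modulo.≉0-factors 2 a11 a22 a33 d p∤a₁₁a₂₂a₃₃d
      open Count a11 a22 a33 a12 a13 a23 d a11≉0 a22≉0 a33≉0 d≉0
  in  (λ 2∤D → ⊥-elim (2∤D (detG-even a11 a22 a33 a12 a13 a23)))
    , (λ 2<2 → ⊥-elim (ℕ.<-irrefl refl 2<2))
    , (λ 2<2 → ⊥-elim (ℕ.<-irrefl refl 2<2))
    , (λ _ _ → count-all-even , count-all-odd , count-mixed)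
... | inj₂ 2<p =
  let open OddPrime p p-prime 2<p
      a11≉0 , a22≉0 , a33≉0 , d≉0 = ≉0-factors a11 a22 a33 d p∤a₁₁a₂₂a₃₃d
      open Surface a11 a22 a33 a12 a13 a23 d a11≉0 a22≉0 a33≉0 d≉0
      N≡ = solCount-∑ᵣ a11 a22 a33 a12 a13 a23 d
      ∣⇒≈0² : ∀ {a b} → (+ p ∣ a) × (+ p ∣ b) → a ≈ 0ℤ × b ≈ 0ℤ
      ∣⇒≈0² = Product.map ∣⇒≈0 ∣⇒≈0
      ≈0⇒∣² : ∀ {a b} → a ≈ 0ℤ × b ≈ 0ℤ → (+ p ∣ a) × (+ p ∣ b)
      ≈0⇒∣² = Product.map ≈0⇒∣ ≈0⇒∣
  in  (λ p∤D → 2<p , trans N≡ (count-nondegenerate (p∤D ∘ ≈0⇒∣)))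
    , (λ _ p∣D two → trans N≡ (count-two-cofactors-vanish (∣⇒≈0 p∣D) (Sum.map ∣⇒≈0² (Sum.map ∣⇒≈0² ∣⇒≈0²) two)))
    , (λ _ p∣D ¬two j p∤Aj → trans N≡ (count-at-most-one-cofactor-vanishes (∣⇒≈0 p∣D)
                                         (¬two ∘ Sum.map ≈0⇒∣² (Sum.map ≈0⇒∣² ≈0⇒∣²)) j (p∤Aj ∘ ≈0⇒∣)))
    , (λ p≡2 → ⊥-elim (ℕ.<-irrefl (sym p≡2) 2<p))
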